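{- Let $a\ge4$ be an integer. The subtraction game $\mathcal{S}(a,2a+2,3a+3)$ is ultimately periodic with period $4a+3$ and nim-sequence $2^{a-2}\,11\,00\,3^{a-4}\,22\,11\,0^{a-1}\,2\,1^{a-1}\,00$. When $a=4$ the subtraction set is non-expandable; otherwise the subtraction set has expansion $\{a,2a+2,3a+3\}\cup\{3a+4\}^{*(4a+3)}$.
   Context: For a finite set $S$ of positive integers, the subtraction game $\mathcal{S}(S)$ is played on a single pile: two players alternately remove $s\in S$ coins (at most the pile size); the last mover wins. The nim-value is $\mathcal{G}(n)=\operatorname{mex}\{\mathcal{G}(n-s): s\in S, s\le n\}$. Words of single digits are written by juxtaposition, and $x^m$ denotes $m$-fold repetition of the block $x$ ($x^0$ empty). "The game is ultimately periodic with period $p$ and nim-sequence $W$" ($W$ a word of length $p$) means $p$ is the least positive integer with $\mathcal{G}(n+p)=\mathcal{G}(n)$ for all sufficiently large $n$, and there is $n_0\ge0$ such that $\mathcal{G}(n_0+j)$ is the $((j\bmod p)+1)$-st letter of $W$ for all $j\ge0$. The expansion of $S$ is $S^{ex}=\{s\ge1:\mathcal{G}(n+s)\ne\mathcal{G}(n)\ \forall n\ge0\}$; "has expansion $T$" means $S^{ex}=T$. For a set $X$ and $p\ge1$, $X^{*p}=\{x+mp:x\in X,m\ge0\}$. $S$ is non-expandable if $S^{ex}=S$ or $S^{ex}=S^{*p}$, $p$ the period. -}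

module Defs where

open import Data.Nat using (ℕ; zero; suc; _+_; _*_; _∸_; _≤_; _<_; _≡ᵇ_; NonZero)
open import Data.Nat.DivMod using (_%_)
open import Data.Bool using (Bool; true; false; if_then_else_)
open import Data.List using (List; []; _∷_; length; concatMap)
open import Data.Bool.ListAction using (any)
open import Data.Maybe using (Maybe; just; nothing)
open import Data.Product using (Σ; _×_; ∃)
open import Data.Sum using (_⊎_)
open import Relation.Nullary using (¬_)
open import Relation.Binary.PropositionalEquality using (_≡_)

-- mex of a finite list of naturals: least k not occurring in the list.
-- (The mex is at most the length of the list, so searching k = 0 .. length l suffices.)
mexAux : ℕ → ℕ → List ℕ → ℕ
mexAux zero    k l = k
mexAux (suc f) k l = if any (λ x → x ≡ᵇ k) l then mexAux f (suc k) l else k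

mex : List ℕ → ℕ
mex l = mexAux (length l) 0 l

nth : {A : Set} → List A → ℕ → Maybe A
nth []       _       = nothing
nth (x ∷ xs) zero    = just x
nth (x ∷ xs) (suc k) = nth xs k

-- Given prev = [G(n-1), G(n-2), ..., G(0)], the option value G(n-s) for a move s
-- (only if 1 ≤ s ≤ n; otherwise no option).
option : List ℕ → ℕ → List ℕ
option prev zero    = []
option prev (suc k) with nth prev k
... | just v  = v ∷ []
... | nothing = []

nextVal : List ℕ → List ℕ → ℕ
nextVal S prev = mex (concatMap (option prev) S)

table : List ℕ → ℕ → List ℕ
table S zero    = []
table S (suc n) = nextVal S (table S n) ∷ table S n

-- nim-value G(n) = mex { G(n-s) : s ∈ S, s ≤ n } of the subtraction game S(S)
grundy : List ℕ → ℕ → ℕ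
grundy S n = nextVal S (table S n)

IsPeriodFrom : (ℕ → ℕ) → ℕ → Set
IsPeriodFrom g p = ∃ λ N → ∀ n → N ≤ n → g (n + p) ≡ g n

UltPeriodic : (ℕ → ℕ) → (p : ℕ) → .{{_ : NonZero p}} → List ℕ → Set
UltPeriodic g p W =
  length W ≡ p
  × IsPeriodFrom g p
  × (∀ q → 0 < q → q < p → ¬ IsPeriodFrom g q)
  × (∃ λ n₀ → ∀ j → nth W (j % p) ≡ just (g (n₀ + j)))

InExpansion : List ℕ → ℕ → Set
InExpansion S s = 1 ≤ s × (∀ n → ¬ grundy S (n + s) ≡ grundy S n)

HasExpansion : List ℕ → (ℕ → Set) → Set
HasExpansion S T = ∀ s → (InExpansion S s → T s) × (T s → InExpansion S s)

Star : (ℕ → Set) → ℕ → ℕ → Set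
Star X p s = ∃ λ x → ∃ λ m → X x × s ≡ x + m * p

NonExpandable : List ℕ → ℕ → Set
NonExpandable S p = HasExpansion S (λ s → s ∈ₗ S) ⊎ HasExpansion S (Star (λ s → s ∈ₗ S) p)
  where
  open import Data.List.Membership.Propositional renaming (_∈_ to _∈ₗ_)

module Submission where

-- All facts about an ultimately periodic sequence g that the theorem needs can be
-- checked on finitely many positions: G(n + p) = G(n) on one window of length max S after the
-- preperiod N (a subtraction game then repeats for ever, `periodic-from-window`); the values
-- on one period; one violation of each shorter period; separations G(n + s) ≠ G(n) for
-- n < N + p (they then hold everywhere); and repetitions G(r + s) = G(r) for all other shifts
-- s < 3p (`ExpansionData`).
--
-- The finite facts depend on a and are verified by computation.  For a = 6 + c the
-- nim-sequence is a word of runs whose lengths are affine in c (`Symbolic`); positions are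
-- linear forms in c and a free variable u, and Boolean checks at finitely many symbolic points
-- are proved to cover every position (`cover`).  A `Certificate` -- the word and tables of
-- witnesses -- is checked for a = 4, a = 5 and all a = 6 + c at once, yielding the profile of
-- every game; the theorem reads periodicity and the expansion off it.

open import Defs
open import Data.Nat
open import Data.Nat.Properties
open import Data.Nat.DivMod using (_%_; _/_; m%n<n; m≡m%n+[m/n]*n)
open import Data.Nat.Induction using (<-rec)
open import Data.Nat.Solver using (module +-*-Solver)
open import Data.Bool using (Bool; true; false; T; _∧_; _∨_; not; if_then_else_)
open import Data.Bool.Properties using (T-∧; T-∨; T-≡; T-not-≡)
open import Data.Bool.ListAction using (all; any)
open import Data.Maybe using (Maybe; just; nothing)
open import Data.Product using (∃; _×_; _,_; proj₁; proj₂)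
open import Data.Sum using (_⊎_; inj₁; inj₂)
open import Data.Empty using (⊥-elim)
open import Data.List using (List; []; _∷_; _++_; concat; map; replicate; length; upTo; cartesianProduct)
open import Data.List.Properties using (map-cong-local; length-++; length-replicate; ++-assoc)
open import Data.List.Relation.Unary.All as All using (All; []; _∷_)
open import Data.List.Relation.Unary.All.Properties using (all⁺)
open import Data.List.Relation.Unary.Any using (Any; here; there; satisfied)
open import Data.List.Relation.Unary.Any.Properties using (any⁻; map⁺; map⁻; ++⁻)
open import Data.List.Membership.Propositional using (_∈_)
open import Data.List.Membership.Propositional.Properties using (∈-upTo⁺)
open import Data.List.Membership.DecPropositional _≟_ using (_∈?_)
open import Function using (_∘_)
open import Function.Bundles using (Equivalence)
open import Relation.Nullary using (¬_; yes; no)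
open import Relation.Nullary.Decidable using (_×-dec_)
open import Relation.Unary using (Decidable; _≐_)
open import Relation.Binary.PropositionalEquality

open +-*-Solver using (solve; _:=_; _:+_; _:*_; con)

∧-split : ∀ {x y} → T (x ∧ y) → T x × T y
∧-split = Equivalence.to T-∧

¬T⇒≡false : ∀ {b} → ¬ T b → b ≡ false
¬T⇒≡false {true}  ¬t = ⊥-elim (¬t _)
¬T⇒≡false {false} _  = refl

data Split (m : ℕ) : ℕ → Set where
  inside : ∀ {t} → t < m → Split m t
  past   : ∀ t′ → Split m (m + t′)

split : ∀ m t → Split m t
split m t with t <? m
... | yes t<m = inside t<m
... | no t≮m = subst (Split m) (m+[n∸m]≡n (≮⇒≥ t≮m)) (past (t ∸ m))

-- Nim-values of an arbitrary subtraction game S.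

nth-table : ∀ S n k → k < n → nth (table S n) k ≡ just (grundy S (n ∸ suc k))
nth-table S (suc n) zero    _   = refl
nth-table S (suc n) (suc k) k<n = nth-table S n k (≤-pred k<n)

nth-table-beyond : ∀ S n k → n ≤ k → nth (table S n) k ≡ nothing
nth-table-beyond S zero    k       _         = refl
nth-table-beyond S (suc n) (suc k) (s≤s n≤k) = nth-table-beyond S n k n≤k

option-legal : ∀ S n s → 1 ≤ s → s ≤ n → option (table S n) s ≡ grundy S (n ∸ s) ∷ []
option-legal S n (suc k) _ s≤n rewrite nth-table S n k s≤n = refl

option-illegal : ∀ S n s → n < s → option (table S n) s ≡ []
option-illegal S n (suc k) (s≤s n≤k) rewrite nth-table-beyond S n k n≤k = refl

MovesIn : ℕ → List ℕ → Set
MovesIn m S = All (λ s → 1 ≤ s × s ≤ m) S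

-- If G(n + p) = G(n) holds on a window N ≤ n < N + m, where m bounds the moves, it holds
-- for all n ≥ N: beyond the window every option of n + p is the option of n shifted by p.
periodic-from-window : ∀ S m p N → MovesIn m S →
  (∀ n → N ≤ n → n < N + m → grundy S (n + p) ≡ grundy S n) →
  ∀ n → N ≤ n → grundy S (n + p) ≡ grundy S n
periodic-from-window S m p N moves window = <-rec _ step
  where
  step : ∀ n → (∀ {n′} → n′ < n → N ≤ n′ → grundy S (n′ + p) ≡ grundy S n′) →
         N ≤ n → grundy S (n + p) ≡ grundy S n
  step n IH N≤n with n <? N + m
  ... | yes n<N+m = window n N≤n n<N+m
  ... | no n≮N+m = cong mex (cong concat (map-cong-local (shift-all moves)))
    where
    late : N + m ≤ n
    late = ≮⇒≥ n≮N+m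
    shift : ∀ s → 1 ≤ s × s ≤ m → option (table S (n + p)) s ≡ option (table S n) s
    shift s (1≤s , s≤m) = begin
      option (table S (n + p)) s   ≡⟨ option-legal S (n + p) s 1≤s (≤-trans s≤n (m≤m+n n p)) ⟩
      grundy S (n + p ∸ s) ∷ []   ≡⟨ cong (λ k → grundy S k ∷ []) (+-∸-comm p s≤n) ⟩
      grundy S (n ∸ s + p) ∷ []   ≡⟨ cong (_∷ []) (IH (∸-monoʳ-< 1≤s s≤n) N≤n∸s) ⟩
      grundy S (n ∸ s) ∷ []       ≡⟨ sym (option-legal S n s 1≤s s≤n) ⟩
      option (table S n) s        ∎
      where
      open ≡-Reasoning
      s≤n : s ≤ n
      s≤n = ≤-trans (≤-trans s≤m (m≤n+m m N)) late
      N≤n∸s : N ≤ n ∸ s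
      N≤n∸s = ≤-trans (≤-reflexive (sym (m+n∸n≡m N s)))
                (∸-monoˡ-≤ s (≤-trans (+-monoʳ-≤ N s≤m) late))
    shift-all : ∀ {T} → MovesIn m T → All (λ s → option (table S (n + p)) s ≡ option (table S n) s) T
    shift-all []             = []
    shift-all (bounds ∷ Ts) = shift _ bounds ∷ shift-all Ts

-- Shifts of a sequence g.

Separating : (ℕ → ℕ) → ℕ → Set
Separating g s = ∀ n → g (n + s) ≢ g n

separating-positive : ∀ {g s} → Separating g s → 1 ≤ s
separating-positive {s = zero}  sep = ⊥-elim (sep 0 refl)
separating-positive {s = suc s} sep = s≤s z≤n

-- What determines the expansion {s : s separates g} of a sequence with period p from N:
-- base separations B and seeds Sp, checked on finitely many positions, and for every other
-- shift below 3p a repetition g(r + s) = g(r).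
record ExpansionData (g : ℕ → ℕ) (p N : ℕ) (B Sp : ℕ → Set) : Set where
  field
    base-separates  : ∀ b → B b → ∀ n → n < N + p → g (n + b) ≢ g n
    seed-separates  : ∀ q → Sp q → ∀ n → n < N + p → g (n + q) ≢ g n
    seed-shifted    : ∀ q → Sp q → ∀ n → n < N → g (n + (q + p)) ≢ g n
    seed-late       : ∀ q → Sp q → N ≤ q + p
    short-repeat    : ∀ q → 0 < q → q < p → ¬ B q → ¬ Sp q → ∃ λ r → g (r + q) ≡ g r
    shifted-repeat  : ∀ q → q < p → ¬ Sp q → ∃ λ r → g (r + (q + p)) ≡ g r
    shifted-repeat₂ : ∀ q → q < p → ¬ Sp q → ∃ λ r → g (r + (q + (p + p))) ≡ g r

module Periodic (g : ℕ → ℕ) (p N : ℕ) .{{_ : NonZero p}}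
                (periodic : ∀ n → N ≤ n → g (n + p) ≡ g n) where

  period-multiple : ∀ k n → N ≤ n → g (n + k * p) ≡ g n
  period-multiple zero    n N≤n = cong g (+-identityʳ n)
  period-multiple (suc k) n N≤n = begin
    g (n + (p + k * p))   ≡⟨ cong g (solve 3 (λ n p q → n :+ (p :+ q) := n :+ q :+ p) refl n p (k * p)) ⟩
    g (n + k * p + p)     ≡⟨ periodic (n + k * p) (≤-trans N≤n (m≤m+n n _)) ⟩
    g (n + k * p)         ≡⟨ period-multiple k n N≤n ⟩
    g n                   ∎
    where open ≡-Reasoning

  fold-into-window : ∀ n → N ≤ n → ∃ λ n′ → ∃ λ k → N ≤ n′ × n′ < N + p × n′ + k * p ≡ n
  fold-into-window n N≤n =
    N + d % p , d / p , m≤m+n N _ , +-monoʳ-< N (m%n<n d p) ,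
    trans (+-assoc N (d % p) _) (trans (cong (N +_) (sym (m≡m%n+[m/n]*n d p))) (m+[n∸m]≡n N≤n))
    where d = n ∸ N

  -- Separation need only be checked below N + p: later positions fold back into the window.
  separating-from-window : ∀ s → (∀ n → n < N + p → g (n + s) ≢ g n) → Separating g s
  separating-from-window s early n with n <? N + p
  ... | yes n<N+p = early n n<N+p
  ... | no n≮N+p with fold-into-window n (≤-trans (m≤m+n N p) (≮⇒≥ n≮N+p))
  ... | n′ , k , N≤n′ , n′<N+p , refl = λ eq → early n′ n′<N+p (begin
    g (n′ + s)            ≡⟨ sym (period-multiple k (n′ + s) (≤-trans N≤n′ (m≤m+n n′ s))) ⟩
    g (n′ + s + k * p)    ≡⟨ cong g (solve 3 (λ a b c → a :+ b :+ c := a :+ c :+ b) refl n′ s (k * p)) ⟩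
    g (n′ + k * p + s)    ≡⟨ eq ⟩
    g (n′ + k * p)        ≡⟨ period-multiple k n′ N≤n′ ⟩
    g n′                  ∎)
    where open ≡-Reasoning

  least-period : (∀ q → 0 < q → q < p → ∃ λ r → N ≤ r × g (r + q) ≢ g r) →
                 ∀ q → 0 < q → q < p → ¬ IsPeriodFrom g q
  least-period violated q 0<q q<p (M , periodic-q) with violated q 0<q q<p
  ... | r , N≤r , neq = neq (begin
    g (r + q)              ≡⟨ sym (period-multiple M (r + q) (≤-trans N≤r (m≤m+n r q))) ⟩
    g (r + q + M * p)      ≡⟨ cong g (solve 3 (λ a b c → a :+ b :+ c := a :+ c :+ b) refl r q (M * p)) ⟩
    g (r + M * p + q)      ≡⟨ periodic-q (r + M * p) (≤-trans (m≤m*n M p) (m≤n+m _ r)) ⟩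
    g (r + M * p)          ≡⟨ period-multiple M r N≤r ⟩
    g r                    ∎)
    where open ≡-Reasoning

  ultimately-periodic : ∀ W n₀ → length W ≡ p → N ≤ n₀ →
    (∀ i → i < p → nth W i ≡ just (g (n₀ + i))) →
    (∀ q → 0 < q → q < p → ∃ λ r → N ≤ r × g (r + q) ≢ g r) → UltPeriodic g p W
  ultimately-periodic W n₀ |W|≡p N≤n₀ window violated =
    |W|≡p , (N , periodic) , least-period violated , (n₀ , reads)
    where
    reads : ∀ j → nth W (j % p) ≡ just (g (n₀ + j))
    reads j = trans (window (j % p) (m%n<n j p)) (cong just (begin
      g (n₀ + j % p)                   ≡⟨ sym (period-multiple (j / p) _ (≤-trans N≤n₀ (m≤m+n n₀ _))) ⟩
      g (n₀ + j % p + j / p * p)       ≡⟨ cong g (trans (+-assoc n₀ _ _) (cong (n₀ +_) (sym (m≡m%n+[m/n]*n j p)))) ⟩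
      g (n₀ + j)                       ∎))
      where open ≡-Reasoning

  module _ {B Sp : ℕ → Set} (E : ExpansionData g p N B Sp) where
    open ExpansionData E

    seed-translates-separate : ∀ q → Sp q → ∀ m → Separating g (q + m * p)
    seed-translates-separate q q∈ zero n =
      subst (λ s → g (n + s) ≢ g n) (sym (+-identityʳ q)) (separating-from-window q (seed-separates q q∈) n)
    seed-translates-separate q q∈ (suc m) n with n <? N
    ... | yes n<N = λ eq → seed-shifted q q∈ n n<N (begin
      g (n + (q + p))
        ≡⟨ sym (period-multiple m _ (≤-trans (seed-late q q∈) (m≤n+m _ n))) ⟩
      g (n + (q + p) + m * p)
        ≡⟨ cong g (solve 4 (λ n q p x → n :+ (q :+ p) :+ x := n :+ (q :+ (p :+ x))) refl n q p (m * p)) ⟩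
      g (n + (q + (p + m * p)))
        ≡⟨ eq ⟩
      g n ∎)
      where open ≡-Reasoning
    ... | no n≮N = λ eq → separating-from-window q (seed-separates q q∈) n (begin
      g (n + q)                      ≡⟨ sym (period-multiple (suc m) _ (≤-trans (≮⇒≥ n≮N) (m≤m+n n q))) ⟩
      g (n + q + (p + m * p))        ≡⟨ cong g (+-assoc n q _) ⟩
      g (n + (q + (p + m * p)))      ≡⟨ eq ⟩
      g n                            ∎)
      where open ≡-Reasoning

    -- Conversely a separating shift is a base separation or a translate of a seed: write
    -- s = q + k p; for k = 0, 1 and (as N ≤ 2p, by periodicity) k ≥ 2 the repetitions rule out
    -- every other case.
    separating-classified : N ≤ p + p → Decidable B → Decidable Sp →
                            ∀ s → Separating g s → B s ⊎ Star Sp p s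
    separating-classified N≤2p B? Sp? s sep with Sp? (s % p)
    ... | yes q∈Sp = inj₂ (s % p , s / p , q∈Sp , m≡m%n+[m/n]*n s p)
    ... | no q∉Sp = by-quotient (s / p) (m≡m%n+[m/n]*n s p)
      where
      q = s % p
      q<p = m%n<n s p
      contradicts : ∀ {s′} → s ≡ s′ → ∃ (λ r → g (r + s′) ≡ g r) → B s ⊎ Star Sp p s
      contradicts refl (r , eq) = ⊥-elim (sep r eq)
      by-quotient : ∀ k → s ≡ q + k * p → B s ⊎ Star Sp p s
      by-quotient zero s≡q with B? s
      ... | yes s∈B = inj₁ s∈B
      ... | no s∉B = contradicts s≡q′ (short-repeat q 0<q q<p (s∉B ∘ subst B (sym s≡q′)) q∉Sp)
        where
        s≡q′ : s ≡ q
        s≡q′ = trans s≡q (+-identityʳ q)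
        0<q : 0 < q
        0<q = subst (0 <_) s≡q′ (separating-positive sep)
      by-quotient (suc zero) s≡q+p =
        contradicts (trans s≡q+p (cong (q +_) (+-identityʳ p))) (shifted-repeat q q<p q∉Sp)
      by-quotient (suc (suc k)) s≡ with shifted-repeat₂ q q<p q∉Sp
      ... | r , eq = contradicts s≡ (r , (begin
        g (r + (q + (p + (p + k * p))))
          ≡⟨ cong g (solve 4 (λ r q p x → r :+ (q :+ (p :+ (p :+ x))) := r :+ (q :+ (p :+ p)) :+ x) refl r q p (k * p)) ⟩
        g (r + (q + (p + p)) + k * p)
          ≡⟨ period-multiple k _ (≤-trans N≤2p (≤-trans (m≤n+m _ q) (m≤n+m _ r))) ⟩
        g (r + (q + (p + p)))
          ≡⟨ eq ⟩
        g r ∎))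
        where open ≡-Reasoning

    expansion : N ≤ p + p → Decidable B → Decidable Sp → ∀ s →
      (1 ≤ s × Separating g s → B s ⊎ Star Sp p s) × (B s ⊎ Star Sp p s → 1 ≤ s × Separating g s)
    expansion N≤2p B? Sp? s = (λ (_ , sep) → separating-classified N≤2p B? Sp? s sep) , separates
      where
      with-positivity : Separating g s → 1 ≤ s × Separating g s
      with-positivity sep = separating-positive sep , sep
      separates : B s ⊎ Star Sp p s → 1 ≤ s × Separating g s
      separates (inj₁ s∈B) = with-positivity (separating-from-window s (base-separates s s∈B))
      separates (inj₂ (q , m , q∈Sp , refl)) = with-positivity (seed-translates-separate q q∈Sp m)

record PeriodicProfile (g : ℕ → ℕ) (p : ℕ) (W : List ℕ) (B Sp : ℕ → Set) : Set where
  field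
    start            : ℕ
    start≤2p         : start ≤ p + p
    periodic         : ∀ n → start ≤ n → g (n + p) ≡ g n
    offset           : ℕ
    offset-late      : start ≤ offset
    window-length    : length W ≡ p
    window           : ∀ i → i < p → nth W i ≡ just (g (offset + i))
    shorter-violated : ∀ q → 0 < q → q < p → ∃ λ r → start ≤ r × g (r + q) ≢ g r
    expansion-data   : ExpansionData g p start B Sp

module _ {g p W B Sp} .{{_ : NonZero p}} (P : PeriodicProfile g p W B Sp) where
  open PeriodicProfile P
  open Periodic g p start periodic

  profile-periodic : UltPeriodic g p W
  profile-periodic = ultimately-periodic W offset window-length offset-late window shorter-violated

  profile-expansion : Decidable B → Decidable Sp → ∀ s →
    (1 ≤ s × Separating g s → B s ⊎ Star Sp p s) × (B s ⊎ Star Sp p s → 1 ≤ s × Separating g s)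
  profile-expansion = expansion expansion-data start≤2p

Sub : ℕ → List ℕ
Sub a = a ∷ (2 * a + 2) ∷ (3 * a + 3) ∷ []

nimSeq : ℕ → List ℕ
nimSeq a = replicate (a ∸ 2) 2 ++ (1 ∷ 1 ∷ 0 ∷ 0 ∷ []) ++ replicate (a ∸ 4) 3 ++ (2 ∷ 2 ∷ 1 ∷ 1 ∷ [])
             ++ replicate (a ∸ 1) 0 ++ (2 ∷ []) ++ replicate (a ∸ 1) 1 ++ (0 ∷ 0 ∷ [])

Seed : ℕ → ℕ → Set
Seed a q = 5 ≤ a × q ≡ 3 * a + 4

Seed? : ∀ a → Decidable (Seed a)
Seed? a q = (5 ≤? a) ×-dec (q ≟ 3 * a + 4)

Sub-bounded : ∀ a → 1 ≤ a → MovesIn (3 * a + 3) (Sub a)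
Sub-bounded a 1≤a =
  (1≤a , ≤-trans (m≤m+n a (2 * a)) (m≤m+n (3 * a) 3)) ∷
  (≤-trans (s≤s z≤n) (m≤n+m 2 (2 * a)) , +-mono-≤ (*-monoˡ-≤ a {2} {3} (n≤1+n 2)) (n≤1+n 2)) ∷
  (≤-trans (s≤s z≤n) (m≤n+m 3 (3 * a)) , ≤-refl) ∷ []

length-replicate-++ : ∀ n (x : ℕ) ys → length (replicate n x ++ ys) ≡ n + length ys
length-replicate-++ n x ys = trans (length-++ (replicate n x)) (cong (_+ length ys) (length-replicate n))

nimSeq-length : ∀ a → 4 ≤ a → length (nimSeq a) ≡ 3 + 4 * a
nimSeq-length .(4 + b) (s≤s (s≤s (s≤s (s≤s {n = b} z≤n)))) = begin
  length (nimSeq (4 + b))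
    ≡⟨ length-replicate-++ (2 + b) 2 _ ⟩
  (2 + b) + (4 + length (replicate b 3 ++ rest₃))
    ≡⟨ cong (λ k → (2 + b) + (4 + k)) (length-replicate-++ b 3 _) ⟩
  (2 + b) + (4 + (b + (4 + length (replicate (3 + b) 0 ++ rest₀))))
    ≡⟨ cong (λ k → (2 + b) + (4 + (b + (4 + k)))) (length-replicate-++ (3 + b) 0 _) ⟩
  (2 + b) + (4 + (b + (4 + ((3 + b) + (1 + length (replicate (3 + b) 1 ++ 0 ∷ 0 ∷ []))))))
    ≡⟨ cong (λ k → (2 + b) + (4 + (b + (4 + ((3 + b) + (1 + k)))))) (length-replicate-++ (3 + b) 1 _) ⟩
  (2 + b) + (4 + (b + (4 + ((3 + b) + (1 + ((3 + b) + 2))))))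
    ≡⟨ solve 1 (λ b → (con 2 :+ b) :+ (con 4 :+ (b :+ (con 4 :+ ((con 3 :+ b) :+ (con 1 :+ ((con 3 :+ b) :+ con 2))))))
                      := con 3 :+ con 4 :* (con 4 :+ b)) refl b ⟩
  3 + 4 * (4 + b) ∎
  where
  open ≡-Reasoning
  rest₀ = 2 ∷ replicate (3 + b) 1 ++ 0 ∷ 0 ∷ []
  rest₃ = 2 ∷ 2 ∷ 1 ∷ 1 ∷ replicate (3 + b) 0 ++ rest₀

preperiod≤2p : ∀ a → 6 * a + 6 ≤ (3 + 4 * a) + (3 + 4 * a)
preperiod≤2p a = subst (6 * a + 6 ≤_)
  (solve 1 (λ a → con 6 :* a :+ con 6 :+ con 2 :* a := (con 3 :+ con 4 :* a) :+ (con 3 :+ con 4 :* a)) refl a)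
  (m≤m+n _ (2 * a))

seed-late : ∀ a q → Seed a q → 6 * a + 6 ≤ q + (3 + 4 * a)
seed-late a q (_ , refl) = subst (6 * a + 6 ≤_)
  (solve 1 (λ a → con 6 :* a :+ con 6 :+ (a :+ con 1) := con 3 :* a :+ con 4 :+ (con 3 :+ con 4 :* a)) refl a)
  (m≤m+n _ (a + 1))

-- Symbolic words.  A family of words indexed by a parameter c is described by runs whose
-- lengths are affine in c; positions inside long runs are described by linear forms in c and
-- a free variable u, so a finite computation checks statements for all positions at once.

record Lin : Set where
  constructor ⟨_,_,_⟩
  field
    c-coeff u-coeff constant : ℕ

⟦_⟧ : Lin → ℕ → ℕ → ℕ
⟦ ⟨ a , b , d ⟩ ⟧ c u = a * c + (b * u + d)

record Aff : Set where
  constructor _·c+_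
  field
    slope offset : ℕ

⟦_⟧ᵃ : Aff → ℕ → ℕ
⟦ k ·c+ d ⟧ᵃ c = k * c + d

lin : Aff → Lin
lin (k ·c+ d) = ⟨ k , 0 , d ⟩

_+ᵃ_ : Aff → Aff → Aff
(k ·c+ d) +ᵃ (k′ ·c+ d′) = (k + k′) ·c+ (d + d′)

+ᵃ-sound : ∀ x y c → ⟦ x +ᵃ y ⟧ᵃ c ≡ ⟦ x ⟧ᵃ c + ⟦ y ⟧ᵃ c
+ᵃ-sound (k ·c+ d) (k′ ·c+ d′) c =
  solve 5 (λ k d k′ d′ c → (k :+ k′) :* c :+ (d :+ d′) := k :* c :+ d :+ (k′ :* c :+ d′)) refl k d k′ d′ c

_⊕_ : Lin → Lin → Lin
⟨ a , b , d ⟩ ⊕ ⟨ a′ , b′ , d′ ⟩ = ⟨ a + a′ , b + b′ , d + d′ ⟩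

_⊖_ : Lin → Lin → Lin
⟨ a , b , d ⟩ ⊖ ⟨ a′ , b′ , d′ ⟩ = ⟨ a ∸ a′ , b ∸ b′ , d ∸ d′ ⟩

_≽_ : Lin → Lin → Bool
⟨ a , b , d ⟩ ≽ ⟨ a′ , b′ , d′ ⟩ = (a′ ≤ᵇ a) ∧ (b′ ≤ᵇ b) ∧ (d′ ≤ᵇ d)

_≈ᵇ_ : Lin → Lin → Bool
⟨ a , b , d ⟩ ≈ᵇ ⟨ a′ , b′ , d′ ⟩ = (a ≡ᵇ a′) ∧ (b ≡ᵇ b′) ∧ (d ≡ᵇ d′)

-- A sufficient test for x < y at every u ≤ c + D (substituting the largest u, c + D).
below : ℕ → Lin → Lin → Bool
below D ⟨ a , b , d ⟩ ⟨ a′ , b′ , d′ ⟩ = (a + b ≤ᵇ a′) ∧ (d + b * D <ᵇ d′)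

⊕-sound : ∀ x y c u → ⟦ x ⊕ y ⟧ c u ≡ ⟦ x ⟧ c u + ⟦ y ⟧ c u
⊕-sound ⟨ a , b , d ⟩ ⟨ a′ , b′ , d′ ⟩ c u =
  solve 8 (λ a b d a′ b′ d′ c u → (a :+ a′) :* c :+ ((b :+ b′) :* u :+ (d :+ d′))
                                  := (a :* c :+ (b :* u :+ d)) :+ (a′ :* c :+ (b′ :* u :+ d′)))
        refl a b d a′ b′ d′ c u

⊖-sound : ∀ x y c u → T (x ≽ y) → ⟦ x ⟧ c u ≡ ⟦ y ⟧ c u + ⟦ x ⊖ y ⟧ c u
⊖-sound x@(⟨ a , b , d ⟩) y@(⟨ a′ , b′ , d′ ⟩) c u x≽y
  with ∧-split {a′ ≤ᵇ a} x≽y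
... | a′≤a , rest with ∧-split {b′ ≤ᵇ b} rest
... | b′≤b , d′≤d = begin
  ⟦ x ⟧ c u                                                ≡⟨ sym (restore a′≤a b′≤b d′≤d) ⟩
  ⟦ ⟨ a′ + (a ∸ a′) , b′ + (b ∸ b′) , d′ + (d ∸ d′) ⟩ ⟧ c u ≡⟨ ⊕-sound y (x ⊖ y) c u ⟩
  ⟦ y ⟧ c u + ⟦ x ⊖ y ⟧ c u                                ∎
  where
  open ≡-Reasoning
  restore : T (a′ ≤ᵇ a) → T (b′ ≤ᵇ b) → T (d′ ≤ᵇ d) →
            ⟦ ⟨ a′ + (a ∸ a′) , b′ + (b ∸ b′) , d′ + (d ∸ d′) ⟩ ⟧ c u ≡ ⟦ x ⟧ c u
  restore ha hb hd
    rewrite m+[n∸m]≡n (≤ᵇ⇒≤ a′ a ha) | m+[n∸m]≡n (≤ᵇ⇒≤ b′ b hb) | m+[n∸m]≡n (≤ᵇ⇒≤ d′ d hd) = refl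

≈ᵇ-sound : ∀ x y c u → T (x ≈ᵇ y) → ⟦ x ⟧ c u ≡ ⟦ y ⟧ c u
≈ᵇ-sound ⟨ a , b , d ⟩ ⟨ a′ , b′ , d′ ⟩ c u x≈y with ∧-split {a ≡ᵇ a′} x≈y
... | a≡a′ , rest with ∧-split {b ≡ᵇ b′} rest
... | b≡b′ , d≡d′ rewrite ≡ᵇ⇒≡ a a′ a≡a′ | ≡ᵇ⇒≡ b b′ b≡b′ | ≡ᵇ⇒≡ d d′ d≡d′ = refl

below-sound : ∀ D x y c u → T (below D x y) → u ≤ c + D → ⟦ x ⟧ c u < ⟦ y ⟧ c u
below-sound D ⟨ a , b , d ⟩ ⟨ a′ , b′ , d′ ⟩ c u x<y u≤c+D with ∧-split {a + b ≤ᵇ a′} x<y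
... | coeffs , consts = begin-strict
  a * c + (b * u + d)            ≤⟨ +-monoʳ-≤ (a * c) (+-monoˡ-≤ d (*-monoʳ-≤ b u≤c+D)) ⟩
  a * c + (b * (c + D) + d)      ≡⟨ solve 5 (λ a b c D d → a :* c :+ (b :* (c :+ D) :+ d) := (a :+ b) :* c :+ (d :+ b :* D)) refl a b c D d ⟩
  (a + b) * c + (d + b * D)      <⟨ +-monoʳ-< ((a + b) * c) (<ᵇ⇒< (d + b * D) d′ consts) ⟩
  (a + b) * c + d′               ≤⟨ +-monoˡ-≤ d′ (*-monoˡ-≤ c (≤ᵇ⇒≤ (a + b) a′ coeffs)) ⟩
  a′ * c + d′                    ≤⟨ +-monoʳ-≤ (a′ * c) (m≤n+m d′ (b′ * u)) ⟩
  a′ * c + (b′ * u + d′)         ∎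
  where open ≤-Reasoning

record Run : Set where
  constructor run
  field
    value slope count : ℕ

extent : Run → Aff
extent (run _ l k) = l ·c+ k

Word : Set
Word = List Run

extentᵂ : Word → Aff
extentᵂ []      = 0 ·c+ 0
extentᵂ (r ∷ R) = extent r +ᵃ extentᵂ R

distinct same : ℕ → ℕ → Bool
distinct v w = not (v ≡ᵇ w)
same = _≡ᵇ_

distinct-sound : ∀ {v w} → T (distinct v w) → v ≢ w
distinct-sound {v} {w} H refl = subst T (Equivalence.to T-not-≡ H) (≡⇒≡ᵇ v v refl)

-- A certificate for a family of games: the moves; the seeds of the infinite part of the
-- expansion; the nim-sequence as a prefix followed by the period block₁ ++ block₂ repeated;
-- and tables of witnesses for the shifts q < p, keyed by the symbolic points of the block.
record Certificate : Set where
  field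
    moves seeds                  : List Aff
    prefix block₁ block₂         : Word
    shorter-table repeat-table   : List (Lin × Aff)
    shifted-table shifted-table₂ : List (Lin × Aff)

module Symbolic (c : ℕ) where

  size₁ : Run → ℕ
  size₁ r = ⟦ extent r ⟧ᵃ c

  size : Word → ℕ
  size []      = 0
  size (r ∷ R) = size₁ r + size R

  at : Word → ℕ → ℕ
  at []      n = 0
  at (r ∷ R) n = if n <ᵇ size₁ r then Run.value r else at R (n ∸ size₁ r)

  size-++ : ∀ P Q → size (P ++ Q) ≡ size P + size Q
  size-++ []      Q = refl
  size-++ (r ∷ P) Q = trans (cong (size₁ r +_) (size-++ P Q)) (sym (+-assoc (size₁ r) (size P) (size Q)))

  size-extent : ∀ R → size R ≡ ⟦ extentᵂ R ⟧ᵃ c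
  size-extent []             = refl
  size-extent (run v l k ∷ R) with extentᵂ R | size-extent R
  ... | L ·c+ K | eq = trans (cong (l * c + k +_) eq)
    (solve 5 (λ l c k L K → l :* c :+ k :+ (L :* c :+ K) := (l :+ L) :* c :+ (k :+ K)) refl l c k L K)

  at-here : ∀ r R n → n < size₁ r → at (r ∷ R) n ≡ Run.value r
  at-here r R n n<r rewrite Equivalence.to T-≡ (<⇒<ᵇ n<r) = refl

  at-skip : ∀ r R n → at (r ∷ R) (size₁ r + n) ≡ at R n
  at-skip r R n rewrite ¬T⇒≡false (≤⇒≯ (m≤m+n (size₁ r) n) ∘ <ᵇ⇒< _ _) | m+n∸m≡n (size₁ r) n = refl

  at-++-past : ∀ P Q n → at (P ++ Q) (size P + n) ≡ at Q n
  at-++-past []      Q n = refl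
  at-++-past (r ∷ P) Q n = trans (cong (at (r ∷ P ++ Q)) (+-assoc (size₁ r) (size P) n))
                                  (trans (at-skip r (P ++ Q) _) (at-++-past P Q n))

  at-++-inside : ∀ P Q n → n < size P → at (P ++ Q) n ≡ at P n
  at-++-inside (r ∷ P) Q n n<rP with split (size₁ r) n
  ... | inside n<r = trans (at-here r (P ++ Q) n n<r) (sym (at-here r P n n<r))
  ... | past n′ = trans (at-skip r (P ++ Q) n′)
                   (trans (at-++-inside P Q n′ (+-cancelˡ-< (size₁ r) _ _ n<rP)) (sym (at-skip r P n′)))

  expand : Word → List ℕ
  expand []      = []
  expand (r ∷ R) = replicate (size₁ r) (Run.value r) ++ expand R

  nth-expand : ∀ R i → i < size R → nth (expand R) i ≡ just (at R i)
  nth-expand (r ∷ R) i i<rR with split (size₁ r) i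
  ... | inside i<r = trans (in-run (size₁ r) i i<r) (cong just (sym (at-here r R i i<r)))
    where
    in-run : ∀ m i → i < m → nth (replicate m (Run.value r) ++ expand R) i ≡ just (Run.value r)
    in-run (suc m) zero    _         = refl
    in-run (suc m) (suc i) (s≤s i<m) = in-run m i i<m
  ... | past i′ = trans (past-run (size₁ r) i′)
      (trans (nth-expand R i′ (+-cancelˡ-< (size₁ r) i′ (size R) i<rR)) (cong just (sym (at-skip r R i′))))
    where
    past-run : ∀ m i → nth (replicate m (Run.value r) ++ expand R) (m + i) ≡ nth (expand R) i
    past-run zero    i = refl
    past-run (suc m) i = past-run m i

  at-period : ∀ X t → t < size X + size X → at (X ++ X ++ X) (t + size X) ≡ at (X ++ X ++ X) t
  at-period X t t<2X with split (size X) t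
  ... | inside t<X = begin
    at (X ++ X ++ X) (t + size X)   ≡⟨ cong (at (X ++ X ++ X)) (+-comm t (size X)) ⟩
    at (X ++ X ++ X) (size X + t)   ≡⟨ at-++-past X (X ++ X) t ⟩
    at (X ++ X) t                   ≡⟨ at-++-inside X X t t<X ⟩
    at X t                          ≡⟨ sym (at-++-inside X (X ++ X) t t<X) ⟩
    at (X ++ X ++ X) t              ∎
    where open ≡-Reasoning
  ... | past t′ = begin
    at (X ++ X ++ X) (size X + t′ + size X)   ≡⟨ cong (at (X ++ X ++ X)) (+-assoc (size X) t′ (size X)) ⟩
    at (X ++ X ++ X) (size X + (t′ + size X)) ≡⟨ at-++-past X (X ++ X) _ ⟩
    at (X ++ X) (t′ + size X)                 ≡⟨ cong (at (X ++ X)) (+-comm t′ (size X)) ⟩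
    at (X ++ X) (size X + t′)                 ≡⟨ at-++-past X X t′ ⟩
    at X t′                                   ≡⟨ sym (at-++-inside X X t′ t′<X) ⟩
    at (X ++ X) t′                            ≡⟨ sym (at-++-past X (X ++ X) t′) ⟩
    at (X ++ X ++ X) (size X + t′)            ∎
    where
    open ≡-Reasoning
    t′<X : t′ < size X
    t′<X = +-cancelˡ-< (size X) t′ (size X) t<2X

  -- The value at position x of R, provided x lies in one and the same run for every u ≤ c + D.
  lookupˢ : ℕ → Lin → Word → Maybe ℕ
  lookupˢ D x []      = nothing
  lookupˢ D x (r ∷ R) =
    if below D x (lin (extent r)) then just (Run.value r)
    else if x ≽ lin (extent r) then lookupˢ D (x ⊖ lin (extent r)) R
    else nothing

  lookupˢ-sound : ∀ D x R {v} → lookupˢ D x R ≡ just v → ∀ u → u ≤ c + D →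
                  ⟦ x ⟧ c u < size R × at R (⟦ x ⟧ c u) ≡ v
  lookupˢ-sound D x (r ∷ R) eq u u≤ with below D x (lin (extent r)) in inRun
  ... | true with refl ← eq = ≤-trans x<r (m≤m+n (size₁ r) (size R)) , at-here r R _ x<r
    where x<r = below-sound D x (lin (extent r)) c u (Equivalence.from T-≡ inRun) u≤
  ... | false with x ≽ lin (extent r) in later
  ... | true with lookupˢ-sound D (x ⊖ lin (extent r)) R eq u u≤
  ... | x′<R , at-x′ rewrite ⊖-sound x (lin (extent r)) c u (Equivalence.from T-≡ later) =
    +-monoʳ-< (size₁ r) x′<R , trans (at-skip r R _) at-x′

  Values : List Aff → ℕ → Set
  Values ys q = Any (λ y → q ≡ ⟦ y ⟧ᵃ c) ys

  Sound : (Lin → ℕ → Bool) → (ℕ → Set) → Set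
  Sound chk Q = ∀ x D → T (chk x D) → ∀ u → u ≤ c + D → Q (⟦ x ⟧ c u)

  -- The positions of a long run of length c + k, k = h + e + D + 1, split into h head points,
  -- a middle stretch h + u (u ≤ c + D) and e tail points.
  data LongRunPosition (h e D : ℕ) : ℕ → Set where
    head   : ∀ {t} → t < h → LongRunPosition h e D t
    middle : ∀ u → u ≤ c + D → LongRunPosition h e D (h + u)
    tail   : ∀ v → v < e → LongRunPosition h e D (h + (c + suc (D + v)))

  long-run-position : ∀ h e D t → t < c + (suc (h + e) + D) → LongRunPosition h e D t
  long-run-position h e D t t<run with split h t
  ... | inside t<h = head t<h
  ... | past u with split (suc (c + D)) u
  ... | inside u≤ = middle u (≤-pred u≤)
  ... | past v = subst (LongRunPosition h e D) (cong (h +_) shape) (tail v v<e)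
    where
    shape : c + suc (D + v) ≡ suc (c + D) + v
    shape = solve 3 (λ c D v → c :+ (con 1 :+ (D :+ v)) := con 1 :+ (c :+ D) :+ v) refl c D v
    v<e : v < e
    v<e = +-cancelˡ-< (h + suc (c + D)) v e (subst₂ _<_
      (sym (+-assoc h (suc (c + D)) v))
      (solve 4 (λ c h e D → c :+ (con 1 :+ (h :+ e) :+ D) := h :+ (con 1 :+ (c :+ D)) :+ e) refl c h e D)
      t<run)

  allBelow : ℕ → (ℕ → Bool) → Bool
  allBelow k f = all f (upTo k)

  allBelow-sound : ∀ k f {i} → T (allBelow k f) → i < k → T (f i)
  allBelow-sound k f H i<k = All.lookup (all⁺ f (upTo k) H) (∈-upTo⁺ i<k)

  -- The points checked for a run starting at sc·c + s0.  A short run (slope 0) is checked point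
  -- by point; a long run (slope 1, length c + k) through some split k = h + e + D + 1 into head
  -- points, one symbolic middle point of range D, and tail points measured from (sc + 1)·c.
  checkSplit : (Lin → ℕ → Bool) → ℕ → ℕ → ℕ → ℕ → ℕ → Bool
  checkSplit chk sc s0 k h e =
    (suc (h + e) ≤ᵇ k) ∧
    allBelow h (λ i → chk ⟨ sc , 0 , s0 + i ⟩ 0) ∧
    chk ⟨ sc , 1 , s0 + h ⟩ D ∧
    allBelow e (λ v → chk ⟨ suc sc , 0 , s0 + (h + suc (D + v)) ⟩ 0)
    where D = k ∸ suc (h + e)

  checkRun : (Lin → ℕ → Bool) → ℕ → ℕ → Run → Bool
  checkRun chk sc s0 (run _ zero k)          = allBelow k (λ i → chk ⟨ sc , 0 , s0 + i ⟩ 0)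
  checkRun chk sc s0 (run _ (suc zero) k)    =
    any (λ (h , e) → checkSplit chk sc s0 k h e) (cartesianProduct (upTo k) (upTo k))
  checkRun chk sc s0 (run _ (suc (suc _)) k) = false

  checkWord : (Lin → ℕ → Bool) → ℕ → ℕ → Word → Bool
  checkWord chk sc s0 []      = true
  checkWord chk sc s0 (r ∷ R) = checkRun chk sc s0 r ∧ checkWord chk (sc + Run.slope r) (s0 + Run.count r) R

  module _ {chk : Lin → ℕ → Bool} {Q : ℕ → Set} (sound : Sound chk Q) where

    cover-split : ∀ sc s0 k h e → T (checkSplit chk sc s0 k h e) → ∀ t → t < c + k → Q (sc * c + (s0 + t))
    cover-split sc s0 k h e H t t<run with ∧-split H
    ... | fits , H₁ with ∧-split H₁
    ... | heads , H₂ with ∧-split H₂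
    ... | mid , tails = points (long-run-position h e D t (subst (λ k → t < c + k) (sym k≡) t<run))
      where
      D = k ∸ suc (h + e)
      k≡ : suc (h + e) + D ≡ k
      k≡ = m+[n∸m]≡n (≤ᵇ⇒≤ (suc (h + e)) k fits)
      points : ∀ {t} → LongRunPosition h e D t → Q (sc * c + (s0 + t))
      points (head t<h)   = sound _ 0 (allBelow-sound h _ heads t<h) 0 z≤n
      points (middle u u≤) = subst Q
        (solve 5 (λ sc c u s0 h → sc :* c :+ (con 1 :* u :+ (s0 :+ h)) := sc :* c :+ (s0 :+ (h :+ u)))
               refl sc c u s0 h)
        (sound ⟨ sc , 1 , s0 + h ⟩ D mid u u≤)
      points (tail v v<e) = subst Q
        (solve 5 (λ sc c s0 h w → (con 1 :+ sc) :* c :+ (s0 :+ (h :+ w)) := sc :* c :+ (s0 :+ (h :+ (c :+ w))))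
               refl sc c s0 h (suc (D + v)))
        (sound _ 0 (allBelow-sound e _ tails v<e) 0 z≤n)

    cover-run : ∀ sc s0 r → T (checkRun chk sc s0 r) → ∀ t → t < size₁ r → Q (sc * c + (s0 + t))
    cover-run sc s0 (run _ zero k) H t t<k = sound _ 0 (allBelow-sound k _ H t<k) 0 z≤n
    cover-run sc s0 (run _ (suc zero) k) H t t<run with satisfied (any⁻ _ (cartesianProduct (upTo k) (upTo k)) H)
    ... | (h , e) , Hs = cover-split sc s0 k h e Hs t (subst (λ n → t < n + k) (*-identityˡ c) t<run)

    cover-from : ∀ sc s0 R → T (checkWord chk sc s0 R) → ∀ t → t < size R → Q (sc * c + (s0 + t))
    cover-from sc s0 (r@(run _ l k) ∷ R) H t t<rR with ∧-split H | split (size₁ r) t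
    ... | Hr , _  | inside t<r = cover-run sc s0 r Hr t t<r
    ... | _  , HR | past t′    = subst Q
      (solve 6 (λ sc l c s0 k t → (sc :+ l) :* c :+ (s0 :+ k :+ t) := sc :* c :+ (s0 :+ (l :* c :+ k :+ t)))
             refl sc l c s0 k t′)
      (cover-from (sc + l) (s0 + k) R HR t′ (+-cancelˡ-< (size₁ r) t′ (size R) t<rR))

    cover : ∀ R → T (checkWord chk 0 0 R) → ∀ t → t < size R → Q t
    cover = cover-from 0 0

  module Recursion (moves : List Aff) (R : Word) where

    S : List ℕ
    S = map (λ y → ⟦ y ⟧ᵃ c) moves

    optionˢ : ℕ → Lin → Aff → Maybe (List ℕ)
    optionˢ D x y =
      if 1 ≤ᵇ Aff.offset y
      then (if x ≽ lin y then Data.Maybe.map (_∷ []) (lookupˢ D (x ⊖ lin y) R)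
            else if below D x (lin y) then just [] else nothing)
      else nothing

    optionsˢ : ℕ → Lin → List Aff → Maybe (List ℕ)
    optionsˢ D x []       = just []
    optionsˢ D x (y ∷ ys) with optionˢ D x y | optionsˢ D x ys
    ... | just o | just os = just (o ++ os)
    ... | _      | _       = nothing

    checkRec : Lin → ℕ → Bool
    checkRec x D with optionsˢ D x moves | lookupˢ D x R
    ... | just os | just v = mex os ≡ᵇ v
    ... | _       | _      = false

    AgreeBelow : ℕ → Set
    AgreeBelow n = ∀ m → m < n → grundy S m ≡ at R m

    option-sound : ∀ D x y {os} u → u ≤ c + D → AgreeBelow (⟦ x ⟧ c u) → optionˢ D x y ≡ just os →
                   option (table S (⟦ x ⟧ c u)) (⟦ y ⟧ᵃ c) ≡ os
    option-sound D x y u u≤ agree eq with 1 ≤ᵇ Aff.offset y in pos | x ≽ lin y in reach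
    ... | true | true with lookupˢ D (x ⊖ lin y) R in val
    ... | just v with refl ← eq = begin
      option (table S n) s      ≡⟨ option-legal S n s 1≤s (subst (s ≤_) (sym n≡) (m≤m+n s m)) ⟩
      grundy S (n ∸ s) ∷ []     ≡⟨ cong (λ k → grundy S k ∷ []) (trans (cong (_∸ s) n≡) (m+n∸m≡n s m)) ⟩
      grundy S m ∷ []           ≡⟨ cong (_∷ []) (agree m (subst (m <_) (sym n≡) (m<n+m m 1≤s))) ⟩
      at R m ∷ []               ≡⟨ cong (_∷ []) (proj₂ (lookupˢ-sound D (x ⊖ lin y) R val u u≤)) ⟩
      v ∷ []                    ∎
      where
      open ≡-Reasoning
      n = ⟦ x ⟧ c u
      s = ⟦ y ⟧ᵃ c
      m = ⟦ x ⊖ lin y ⟧ c u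
      1≤s : 1 ≤ s
      1≤s = ≤-trans (≤ᵇ⇒≤ 1 (Aff.offset y) (Equivalence.from T-≡ pos)) (m≤n+m _ (Aff.slope y * c))
      n≡ : n ≡ s + m
      n≡ = ⊖-sound x (lin y) c u (Equivalence.from T-≡ reach)
    option-sound D x y u u≤ agree eq | true | false with below D x (lin y) in short
    ... | true with refl ← eq = option-illegal S _ _ (below-sound D x (lin y) c u (Equivalence.from T-≡ short) u≤)

    options-sound : ∀ D x ys {os} u → u ≤ c + D → AgreeBelow (⟦ x ⟧ c u) → optionsˢ D x ys ≡ just os →
                    concat (map (option (table S (⟦ x ⟧ c u))) (map (λ y → ⟦ y ⟧ᵃ c) ys)) ≡ os
    options-sound D x []       u u≤ agree refl = refl
    options-sound D x (y ∷ ys) u u≤ agree eq with optionˢ D x y in eq₁ | optionsˢ D x ys in eq₂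
    ... | just o | just os with refl ← eq =
      cong₂ _++_ (option-sound D x y u u≤ agree eq₁) (options-sound D x ys u u≤ agree eq₂)

    Correct : ℕ → Set
    Correct n = AgreeBelow n → grundy S n ≡ at R n

    recursion-sound : Sound checkRec Correct
    recursion-sound x D H u u≤ agree with optionsˢ D x moves in opts | lookupˢ D x R in val
    ... | just os | just v = begin
      grundy S (⟦ x ⟧ c u)   ≡⟨ cong mex (options-sound D x moves u u≤ agree opts) ⟩
      mex os                 ≡⟨ ≡ᵇ⇒≡ (mex os) v H ⟩
      v                      ≡⟨ sym (proj₂ (lookupˢ-sound D x R val u u≤)) ⟩
      at R (⟦ x ⟧ c u)       ∎
      where open ≡-Reasoning

    grundy-matches : T (checkWord checkRec 0 0 R) → ∀ n → n < size R → grundy S n ≡ at R n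
    grundy-matches H = <-rec _ λ n IH n<R →
      cover {Q = Correct} recursion-sound R H n n<R (λ m m<n → IH m<n (<-trans m<n n<R))

  module Comparisons (R : Word) where

    Related : (ℕ → ℕ → Bool) → ℕ → ℕ → Set
    Related rel n m = n < size R × m < size R × T (rel (at R n) (at R m))

    checkPair : (ℕ → ℕ → Bool) → Lin → Lin → ℕ → Bool
    checkPair rel off x D with lookupˢ D x R | lookupˢ D (x ⊕ off) R
    ... | just v | just w = rel v w
    ... | _      | _      = false

    pair-sound : ∀ rel off x D → T (checkPair rel off x D) → ∀ u → u ≤ c + D →
                 Related rel (⟦ x ⟧ c u) (⟦ x ⟧ c u + ⟦ off ⟧ c u)
    pair-sound rel off x D H u u≤ with lookupˢ D x R in val₁ | lookupˢ D (x ⊕ off) R in val₂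
    ... | just v | just w with lookupˢ-sound D x R val₁ u u≤ | lookupˢ-sound D (x ⊕ off) R val₂ u u≤
    ... | x<R , refl | x+off<R , at-x+off rewrite ⊕-sound x off c u = x<R , x+off<R , subst (λ w → T (rel _ w)) (sym at-x+off) H

    shift-sound : ∀ rel y → Sound (checkPair rel (lin y)) (λ n → Related rel n (n + ⟦ y ⟧ᵃ c))
    shift-sound rel y x D H = pair-sound rel (lin y) x D H

    witnessFor : Lin → List (Lin × Aff) → Maybe Aff
    witnessFor x []             = nothing
    witnessFor x ((x′ , r) ∷ t) = if x ≈ᵇ x′ then just r else witnessFor x t

    checkWitness : (ℕ → ℕ → Bool) → List Aff → List (Lin × Aff) → Aff → Aff → Lin → ℕ → Bool
    checkWitness rel skip table low off x D =
      any (λ y → x ≈ᵇ lin y) skip ∨ witnessed (witnessFor x table)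
      where
      witnessed : Maybe Aff → Bool
      witnessed nothing  = false
      witnessed (just r) = (lin r ≽ lin low) ∧ checkPair rel (x ⊕ lin off) (lin r) D

    Witnessed : (ℕ → ℕ → Bool) → List Aff → Aff → Aff → ℕ → Set
    Witnessed rel skip low off q =
      Values skip q ⊎ ∃ λ r → ⟦ low ⟧ᵃ c ≤ r × Related rel r (r + (q + ⟦ off ⟧ᵃ c))

    witness-sound : ∀ rel skip table low off →
                    Sound (checkWitness rel skip table low off) (Witnessed rel skip low off)
    witness-sound rel skip table low off x D H u u≤ with Equivalence.to T-∨ H
    ... | inj₁ skipped =
      inj₁ (Data.List.Relation.Unary.Any.map (λ {y} → ≈ᵇ-sound x (lin y) c u) (any⁻ _ skip skipped))
    ... | inj₂ found with witnessFor x table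
    ... | just r with ∧-split found
    ... | r≥low , pair with pair-sound rel (x ⊕ lin off) (lin r) D pair u u≤
    ... | related rewrite ⊕-sound x (lin off) c u =
      inj₂ (⟦ r ⟧ᵃ c , subst (⟦ low ⟧ᵃ c ≤_) (sym (⊖-sound (lin r) (lin low) c u r≥low)) (m≤m+n _ _) , related)

  module Certified (C : Certificate) where
    open Certificate C

    block : Word
    block = block₁ ++ block₂

    R : Word
    R = prefix ++ block ++ block ++ block

    open Comparisons R
    open Recursion moves R using (checkRec; grundy-matches)

    zeroᵃ : Aff
    zeroᵃ = 0 ·c+ 0

    separates : Aff → Word → Bool
    separates y W = checkWord (checkPair distinct (lin y)) 0 0 W

    repeats : List Aff → List (Lin × Aff) → Aff → Bool
    repeats skip table off = checkWord (checkWitness same skip table zeroᵃ off) 0 0 block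

    record Valid : Set where
      field
        recursion        : T (checkWord checkRec 0 0 R)
        shorter          : T (checkWord (checkWitness distinct (zeroᵃ ∷ []) shorter-table (extentᵂ prefix) zeroᵃ) 0 0 block)
        moves-separate   : T (all (λ y → separates y (prefix ++ block)) moves)
        seeds-separate   : T (all (λ y → separates y (prefix ++ block)) seeds)
        seeds-shifted    : T (all (λ y → separates y prefix) (map (_+ᵃ extentᵂ block) seeds))
        short-repeats    : T (repeats (zeroᵃ ∷ moves ++ seeds) repeat-table zeroᵃ)
        shifted-repeats  : T (repeats seeds shifted-table (extentᵂ block))
        shifted-repeats₂ : T (repeats seeds shifted-table₂ (extentᵂ block +ᵃ extentᵂ block))

    record Describes (a : ℕ) : Set where
      field
        moves≡  : map (λ y → ⟦ y ⟧ᵃ c) moves ≡ Sub a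
        prefix≡ : ⟦ extentᵂ prefix ⟧ᵃ c ≡ 6 * a + 6
        block≡  : ⟦ extentᵂ block ⟧ᵃ c ≡ 3 + 4 * a
        window≡ : expand (block₂ ++ block₁) ≡ nimSeq a
        seeds≐  : Values seeds ≐ Seed a

    module _ (a : ℕ) (4≤a : 4 ≤ a) (describes : Describes a) (valid : Valid) where
      open Describes describes
      open Valid valid

      g : ℕ → ℕ
      g = grundy (Sub a)
      p N : ℕ
      p = 3 + 4 * a
      N = 6 * a + 6

      |prefix| : size prefix ≡ N
      |prefix| = trans (size-extent prefix) prefix≡

      |block| : size block ≡ p
      |block| = trans (size-extent block) block≡

      |prefix++block| : size (prefix ++ block) ≡ N + p
      |prefix++block| = trans (size-++ prefix block) (cong₂ _+_ |prefix| |block|)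

      |R| : size R ≡ N + (p + (p + p))
      |R| = trans (size-++ prefix _) (cong₂ _+_ |prefix| (trans (size-++ block _)
              (cong₂ _+_ |block| (trans (size-++ block block) (cong₂ _+_ |block| |block|)))))

      g≡at : ∀ n → n < size R → g n ≡ at R n
      g≡at n n<R = subst (λ S → grundy S n ≡ at R n) moves≡ (grundy-matches recursion n n<R)

      related-values : ∀ rel {n m} → Related rel n m → T (rel (g n) (g m))
      related-values rel (n<R , m<R , H) rewrite g≡at _ n<R | g≡at _ m<R = H

      in-R : ∀ {n} → n < N + (p + (p + p)) → n < size R
      in-R = subst (_ <_) (sym |R|)

      -- Periodicity on a window of length 3a + 3, the largest move, after the preperiod.
      window-periodic : ∀ n → N ≤ n → n < N + (3 * a + 3) → g (n + p) ≡ g n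
      window-periodic n N≤n n<window with split N n
      ... | inside n<N = ⊥-elim (<⇒≱ n<N N≤n)
      ... | past t = begin
        g (N + t + p)                                  ≡⟨ g≡at _ (in-R late) ⟩
        at R (N + t + p)
          ≡⟨ cong (at R) (trans (+-assoc N t p) (cong₂ (λ x y → x + (t + y)) (sym |prefix|) (sym |block|))) ⟩
        at R (size prefix + (t + size block))          ≡⟨ at-++-past prefix _ _ ⟩
        at (block ++ block ++ block) (t + size block)  ≡⟨ at-period block t (subst (λ x → t < x + x) (sym |block|) t<2p) ⟩
        at (block ++ block ++ block) t                 ≡⟨ sym (at-++-past prefix _ t) ⟩
        at R (size prefix + t)                         ≡⟨ cong (λ x → at R (x + t)) |prefix| ⟩
        at R (N + t)                                   ≡⟨ sym (g≡at _ (in-R early)) ⟩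
        g (N + t)                                      ∎
        where
        open ≡-Reasoning
        t<2p : t < p + p
        t<2p = <-≤-trans (+-cancelˡ-< N t _ n<window)
                 (≤-trans (m≤m+n (3 * a + 3) (3 + 5 * a))
                   (≤-reflexive (solve 1 (λ a → con 3 :* a :+ con 3 :+ (con 3 :+ con 5 :* a)
                                             := (con 3 :+ con 4 :* a) :+ (con 3 :+ con 4 :* a)) refl a)))
        late : N + t + p < N + (p + (p + p))
        late = subst (_< N + (p + (p + p))) (sym (+-assoc N t p))
                 (+-monoʳ-< N (<-≤-trans (+-monoˡ-< p t<2p) (≤-reflexive (+-comm (p + p) p))))
        early : N + t < N + (p + (p + p))
        early = +-monoʳ-< N (<-≤-trans t<2p (+-monoʳ-≤ p (m≤m+n p p)))

      -- From position N + |block₁| on, R reads the rotated period block₂ ++ block₁.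
      rotated : ∀ i → i < size (block₂ ++ block₁) →
                at R (size prefix + (size block₁ + i)) ≡ at (block₂ ++ block₁) i
      rotated i i<rot = begin
        at R (size prefix + (size block₁ + i))         ≡⟨ at-++-past prefix _ _ ⟩
        at (block ++ rest) (size block₁ + i)           ≡⟨ cong (λ W → at W (size block₁ + i)) (++-assoc block₁ block₂ rest) ⟩
        at (block₁ ++ block₂ ++ rest) (size block₁ + i) ≡⟨ at-++-past block₁ _ i ⟩
        at (block₂ ++ rest) i                          ≡⟨ second-half i (subst (i <_) (size-++ block₂ block₁) i<rot) ⟩
        at (block₂ ++ block₁) i                        ∎
        where
        open ≡-Reasoning
        rest = block ++ block
        second-half : ∀ i → i < size block₂ + size block₁ → at (block₂ ++ rest) i ≡ at (block₂ ++ block₁) i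
        second-half i i<rot with split (size block₂) i
        ... | inside i<b₂ = trans (at-++-inside block₂ rest i i<b₂) (sym (at-++-inside block₂ block₁ i i<b₂))
        ... | past j = begin
          at (block₂ ++ rest) (size block₂ + j)   ≡⟨ at-++-past block₂ rest j ⟩
          at (block ++ block) j                   ≡⟨ cong (λ W → at W j) (++-assoc block₁ block₂ block) ⟩
          at (block₁ ++ block₂ ++ block) j        ≡⟨ at-++-inside block₁ _ j j<b₁ ⟩
          at block₁ j                             ≡⟨ sym (at-++-past block₂ block₁ j) ⟩
          at (block₂ ++ block₁) (size block₂ + j) ∎
          where j<b₁ = +-cancelˡ-< (size block₂) j (size block₁) i<rot

      nim-window : ∀ i → i < p → nth (nimSeq a) i ≡ just (g (N + size block₁ + i))
      nim-window i i<p = begin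
        nth (nimSeq a) i                             ≡⟨ cong (λ W → nth W i) (sym window≡) ⟩
        nth (expand (block₂ ++ block₁)) i            ≡⟨ nth-expand (block₂ ++ block₁) i i<rot ⟩
        just (at (block₂ ++ block₁) i)               ≡⟨ cong just (sym (rotated i i<rot)) ⟩
        just (at R (size prefix + (size block₁ + i)))
          ≡⟨ cong (just ∘ at R) (trans (cong (_+ (size block₁ + i)) |prefix|) (sym (+-assoc N (size block₁) i))) ⟩
        just (at R (N + size block₁ + i))            ≡⟨ cong just (sym (g≡at _ (in-R inside-R))) ⟩
        just (g (N + size block₁ + i))               ∎
        where
        open ≡-Reasoning
        |b₁| : size block₁ ≤ p
        |b₁| = subst (size block₁ ≤_) (trans (sym (size-++ block₁ block₂)) |block|) (m≤m+n _ _)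
        i<rot : i < size (block₂ ++ block₁)
        i<rot = subst (i <_) (trans (sym |block|) (trans (size-++ block₁ block₂)
                  (trans (+-comm (size block₁) (size block₂)) (sym (size-++ block₂ block₁))))) i<p
        inside-R : N + size block₁ + i < N + (p + (p + p))
        inside-R = subst (_< N + (p + (p + p))) (sym (+-assoc N (size block₁) i))
                     (+-monoʳ-< N (<-≤-trans (+-mono-≤-< |b₁| i<p) (+-monoʳ-≤ p (m≤m+n p p))))

      shorter-violated : ∀ q → 0 < q → q < p → ∃ λ r → N ≤ r × g (r + q) ≢ g r
      shorter-violated q 0<q q<p
        with cover {Q = Witnessed distinct (zeroᵃ ∷ []) (extentᵂ prefix) zeroᵃ}
                   (witness-sound distinct (zeroᵃ ∷ []) shorter-table (extentᵂ prefix) zeroᵃ)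
                   block shorter q (subst (q <_) (sym |block|) q<p)
      ... | inj₁ (here q≡0) = ⊥-elim (<⇒≢ 0<q (sym q≡0))
      ... | inj₂ (r , N≤r , related) =
        r , subst (_≤ r) prefix≡ N≤r ,
        λ eq → distinct-sound (related-values distinct related) (sym (trans (cong (λ x → g (r + x)) (+-identityʳ q)) eq))

      separated : ∀ ys W → T (all (λ y → separates y W) ys) → ∀ s → Values ys s →
                  ∀ n → n < size W → g (n + s) ≢ g n
      separated (y ∷ ys) W H s (here refl) n n<W eq = distinct-sound (related-values distinct related) (sym eq)
        where
        related = cover {Q = λ n → Related distinct n (n + s)} (shift-sound distinct y) W (proj₁ (∧-split H)) n n<W
      separated (y ∷ ys) W H s (there s∈ys) = separated ys W (proj₂ (∧-split H)) s s∈ys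

      repetition : ∀ skip table off → T (repeats skip table off) → ∀ q → q < p → ¬ Values skip q →
                   ∃ λ r → g (r + (q + ⟦ off ⟧ᵃ c)) ≡ g r
      repetition skip table off H q q<p q∉skip
        with cover {Q = Witnessed same skip zeroᵃ off} (witness-sound same skip table zeroᵃ off)
                   block H q (subst (q <_) (sym |block|) q<p)
      ... | inj₁ q∈skip = ⊥-elim (q∉skip q∈skip)
      ... | inj₂ (r , _ , related) = r , sym (≡ᵇ⇒≡ _ _ (related-values same related))

      move-values : ∀ {b} → b ∈ Sub a → Values moves b
      move-values b∈ = map⁻ (subst (_ ∈_) (sym moves≡) b∈)

      shifted-values : ∀ {q} → Values seeds q → Values (map (_+ᵃ extentᵂ block) seeds) (q + p)
      shifted-values = map⁺ ∘ Data.List.Relation.Unary.Any.map λ {y} q≡y →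
        trans (cong₂ _+_ q≡y (sym block≡)) (sym (+ᵃ-sound y (extentᵂ block) c))

      expansion-data : ExpansionData g p N (_∈ Sub a) (Seed a)
      expansion-data = record
        { base-separates  = λ b b∈ n n<N+p →
            separated moves (prefix ++ block) moves-separate b (move-values b∈) n (on-period n<N+p)
        ; seed-separates  = λ q q∈ n n<N+p →
            separated seeds (prefix ++ block) seeds-separate q (proj₂ seeds≐ q∈) n (on-period n<N+p)
        ; seed-shifted    = λ q q∈ n n<N →
            separated _ prefix seeds-shifted (q + p) (shifted-values (proj₂ seeds≐ q∈)) n (subst (n <_) (sym |prefix|) n<N)
        ; seed-late       = seed-late a
        ; short-repeat    = λ q 0<q q<p q∉B q∉Sp →
            let r , eq = repetition _ repeat-table zeroᵃ short-repeats q q<p (excluded 0<q q∉B q∉Sp)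
            in r , subst (λ x → g (r + x) ≡ g r) (+-identityʳ q) eq
        ; shifted-repeat  = λ q q<p q∉Sp →
            let r , eq = repetition seeds shifted-table _ shifted-repeats q q<p (q∉Sp ∘ proj₁ seeds≐)
            in r , subst (λ x → g (r + (q + x)) ≡ g r) block≡ eq
        ; shifted-repeat₂ = λ q q<p q∉Sp →
            let r , eq = repetition seeds shifted-table₂ _ shifted-repeats₂ q q<p (q∉Sp ∘ proj₁ seeds≐)
            in r , subst (λ x → g (r + (q + x)) ≡ g r)
                         (trans (+ᵃ-sound (extentᵂ block) _ c) (cong₂ _+_ block≡ block≡)) eq
        }
        where
        on-period : ∀ {n} → n < N + p → n < size (prefix ++ block)
        on-period = subst (_ <_) (sym |prefix++block|)
        excluded : ∀ {q} → 0 < q → ¬ q ∈ Sub a → ¬ Seed a q → ¬ Values (zeroᵃ ∷ moves ++ seeds) q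
        excluded 0<q q∉B q∉Sp (here q≡0) = <⇒≢ 0<q (sym q≡0)
        excluded 0<q q∉B q∉Sp (there q∈) with ++⁻ moves q∈
        ... | inj₁ q∈moves = q∉B (subst (_ ∈_) moves≡ (map⁺ q∈moves))
        ... | inj₂ q∈seeds = q∉Sp (proj₁ seeds≐ q∈seeds)

      profile : PeriodicProfile g p (nimSeq a) (_∈ Sub a) (Seed a)
      profile = record
        { start            = N
        ; start≤2p         = preperiod≤2p a
        ; periodic         = periodic-from-window (Sub a) (3 * a + 3) p N
                               (Sub-bounded a (≤-trans (s≤s z≤n) 4≤a)) window-periodic
        ; offset           = N + size block₁
        ; offset-late      = m≤m+n N _
        ; window-length    = nimSeq-length a 4≤a
        ; window           = nim-window
        ; shorter-violated = shorter-violated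
        ; expansion-data   = expansion-data
        }

certificate₄ : Certificate
certificate₄ = record
  { moves          = 0 ·c+ 4 ∷ 0 ·c+ 10 ∷ 0 ·c+ 15 ∷ []
  ; seeds          = []
  ; prefix         =
      run 0 0 4 ∷ run 1 0 4 ∷ run 0 0 2 ∷ run 2 0 2 ∷ run 1 0 2 ∷
      run 0 0 1 ∷ run 3 0 1 ∷ run 2 0 2 ∷ run 1 0 1 ∷ run 2 0 1 ∷
      run 0 0 3 ∷ run 3 0 1 ∷ run 1 0 3 ∷ run 0 0 2 ∷ run 3 0 1 ∷
      []
  ; block₁         =
      run 2 0 1 ∷ run 1 0 2 ∷ run 0 0 2 ∷ run 3 0 0 ∷ run 2 0 2 ∷
      run 1 0 2 ∷ run 0 0 3 ∷ run 2 0 1 ∷ run 1 0 3 ∷ run 0 0 2 ∷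
      []
  ; block₂         = run 2 0 1 ∷ []
  ; shorter-table  =
      (⟨ 0 , 0 , 1 ⟩ , 0 ·c+ 30) ∷ (⟨ 0 , 0 , 2 ⟩ , 0 ·c+ 30) ∷ (⟨ 0 , 0 , 3 ⟩ , 0 ·c+ 30) ∷
      (⟨ 0 , 0 , 4 ⟩ , 0 ·c+ 30) ∷ (⟨ 0 , 0 , 5 ⟩ , 0 ·c+ 31) ∷ (⟨ 0 , 0 , 6 ⟩ , 0 ·c+ 35) ∷
      (⟨ 0 , 0 , 7 ⟩ , 0 ·c+ 30) ∷ (⟨ 0 , 0 , 8 ⟩ , 0 ·c+ 30) ∷ (⟨ 0 , 0 , 9 ⟩ , 0 ·c+ 30) ∷
      (⟨ 0 , 0 , 10 ⟩ , 0 ·c+ 30) ∷ (⟨ 0 , 0 , 11 ⟩ , 0 ·c+ 30) ∷ (⟨ 0 , 0 , 12 ⟩ , 0 ·c+ 33) ∷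
      (⟨ 0 , 0 , 13 ⟩ , 0 ·c+ 30) ∷ (⟨ 0 , 0 , 14 ⟩ , 0 ·c+ 30) ∷ (⟨ 0 , 0 , 15 ⟩ , 0 ·c+ 30) ∷
      (⟨ 0 , 0 , 16 ⟩ , 0 ·c+ 30) ∷ (⟨ 0 , 0 , 17 ⟩ , 0 ·c+ 30) ∷ (⟨ 0 , 0 , 18 ⟩ , 0 ·c+ 31) ∷
      []
  ; repeat-table   =
      (⟨ 0 , 0 , 1 ⟩ , 0 ·c+ 0) ∷ (⟨ 0 , 0 , 2 ⟩ , 0 ·c+ 0) ∷ (⟨ 0 , 0 , 3 ⟩ , 0 ·c+ 0) ∷
      (⟨ 0 , 0 , 5 ⟩ , 0 ·c+ 3) ∷ (⟨ 0 , 0 , 6 ⟩ , 0 ·c+ 2) ∷ (⟨ 0 , 0 , 7 ⟩ , 0 ·c+ 1) ∷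
      (⟨ 0 , 0 , 8 ⟩ , 0 ·c+ 0) ∷ (⟨ 0 , 0 , 9 ⟩ , 0 ·c+ 0) ∷ (⟨ 0 , 0 , 11 ⟩ , 0 ·c+ 3) ∷
      (⟨ 0 , 0 , 12 ⟩ , 0 ·c+ 2) ∷ (⟨ 0 , 0 , 13 ⟩ , 0 ·c+ 1) ∷ (⟨ 0 , 0 , 14 ⟩ , 0 ·c+ 0) ∷
      (⟨ 0 , 0 , 16 ⟩ , 0 ·c+ 19) ∷ (⟨ 0 , 0 , 17 ⟩ , 0 ·c+ 3) ∷ (⟨ 0 , 0 , 18 ⟩ , 0 ·c+ 2) ∷
      []
  ; shifted-table  =
      (⟨ 0 , 0 , 0 ⟩ , 0 ·c+ 1) ∷ (⟨ 0 , 0 , 1 ⟩ , 0 ·c+ 0) ∷ (⟨ 0 , 0 , 2 ⟩ , 0 ·c+ 0) ∷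
      (⟨ 0 , 0 , 3 ⟩ , 0 ·c+ 0) ∷ (⟨ 0 , 0 , 4 ⟩ , 0 ·c+ 19) ∷ (⟨ 0 , 0 , 5 ⟩ , 0 ·c+ 3) ∷
      (⟨ 0 , 0 , 6 ⟩ , 0 ·c+ 2) ∷ (⟨ 0 , 0 , 7 ⟩ , 0 ·c+ 1) ∷ (⟨ 0 , 0 , 8 ⟩ , 0 ·c+ 0) ∷
      (⟨ 0 , 0 , 9 ⟩ , 0 ·c+ 0) ∷ (⟨ 0 , 0 , 10 ⟩ , 0 ·c+ 19) ∷ (⟨ 0 , 0 , 11 ⟩ , 0 ·c+ 3) ∷
      (⟨ 0 , 0 , 12 ⟩ , 0 ·c+ 2) ∷ (⟨ 0 , 0 , 13 ⟩ , 0 ·c+ 1) ∷ (⟨ 0 , 0 , 14 ⟩ , 0 ·c+ 0) ∷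
      (⟨ 0 , 0 , 15 ⟩ , 0 ·c+ 0) ∷ (⟨ 0 , 0 , 16 ⟩ , 0 ·c+ 19) ∷ (⟨ 0 , 0 , 17 ⟩ , 0 ·c+ 3) ∷
      (⟨ 0 , 0 , 18 ⟩ , 0 ·c+ 2) ∷
      []
  ; shifted-table₂ =
      (⟨ 0 , 0 , 0 ⟩ , 0 ·c+ 1) ∷ (⟨ 0 , 0 , 1 ⟩ , 0 ·c+ 0) ∷ (⟨ 0 , 0 , 2 ⟩ , 0 ·c+ 0) ∷
      (⟨ 0 , 0 , 3 ⟩ , 0 ·c+ 0) ∷ (⟨ 0 , 0 , 4 ⟩ , 0 ·c+ 19) ∷ (⟨ 0 , 0 , 5 ⟩ , 0 ·c+ 3) ∷
      (⟨ 0 , 0 , 6 ⟩ , 0 ·c+ 2) ∷ (⟨ 0 , 0 , 7 ⟩ , 0 ·c+ 1) ∷ (⟨ 0 , 0 , 8 ⟩ , 0 ·c+ 0) ∷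
      (⟨ 0 , 0 , 9 ⟩ , 0 ·c+ 0) ∷ (⟨ 0 , 0 , 10 ⟩ , 0 ·c+ 19) ∷ (⟨ 0 , 0 , 11 ⟩ , 0 ·c+ 3) ∷
      (⟨ 0 , 0 , 12 ⟩ , 0 ·c+ 2) ∷ (⟨ 0 , 0 , 13 ⟩ , 0 ·c+ 1) ∷ (⟨ 0 , 0 , 14 ⟩ , 0 ·c+ 0) ∷
      (⟨ 0 , 0 , 15 ⟩ , 0 ·c+ 0) ∷ (⟨ 0 , 0 , 16 ⟩ , 0 ·c+ 19) ∷ (⟨ 0 , 0 , 17 ⟩ , 0 ·c+ 3) ∷
      (⟨ 0 , 0 , 18 ⟩ , 0 ·c+ 2) ∷
      []
  }

profile₄ : PeriodicProfile (grundy (Sub 4)) 19 (nimSeq 4) (_∈ Sub 4) (Seed 4)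
profile₄ = Certified.profile certificate₄ 4 ≤-refl describes _
  where
  open Symbolic 0
  describes : Certified.Describes certificate₄ 4
  describes = record
    { moves≡ = refl ; prefix≡ = refl ; block≡ = refl ; window≡ = refl
    ; seeds≐ = (λ ()) , λ { (s≤s (s≤s (s≤s (s≤s ()))) , _) } }

single-seed : ∀ c a σ → 5 ≤ a → ⟦ σ ⟧ᵃ c ≡ 3 * a + 4 → Symbolic.Values c (σ ∷ []) ≐ Seed a
single-seed c a σ 5≤a σ≡ =
  (λ { (here q≡σ) → 5≤a , trans q≡σ σ≡ }) , λ (_ , q≡) → here (trans q≡ (sym σ≡))

certificate₅ : Certificate
certificate₅ = record
  { moves          = 0 ·c+ 5 ∷ 0 ·c+ 12 ∷ 0 ·c+ 18 ∷ []
  ; seeds          = 0 ·c+ 19 ∷ []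
  ; prefix         =
      run 0 0 5 ∷ run 1 0 5 ∷ run 0 0 2 ∷ run 2 0 3 ∷ run 1 0 2 ∷
      run 0 0 1 ∷ run 3 0 2 ∷ run 2 0 2 ∷ run 1 0 1 ∷ run 2 0 1 ∷
      run 0 0 4 ∷ run 3 0 1 ∷ run 1 0 4 ∷ run 0 0 2 ∷ run 3 0 1 ∷
      []
  ; block₁         =
      run 2 0 2 ∷ run 1 0 2 ∷ run 0 0 2 ∷ run 3 0 1 ∷ run 2 0 2 ∷
      run 1 0 2 ∷ run 0 0 4 ∷ run 2 0 1 ∷ run 1 0 4 ∷ run 0 0 2 ∷
      []
  ; block₂         = run 2 0 1 ∷ []
  ; shorter-table  =
      (⟨ 0 , 0 , 1 ⟩ , 0 ·c+ 37) ∷ (⟨ 0 , 0 , 2 ⟩ , 0 ·c+ 36) ∷ (⟨ 0 , 0 , 3 ⟩ , 0 ·c+ 36) ∷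
      (⟨ 0 , 0 , 4 ⟩ , 0 ·c+ 36) ∷ (⟨ 0 , 0 , 5 ⟩ , 0 ·c+ 36) ∷ (⟨ 0 , 0 , 6 ⟩ , 0 ·c+ 36) ∷
      (⟨ 0 , 0 , 7 ⟩ , 0 ·c+ 42) ∷ (⟨ 0 , 0 , 8 ⟩ , 0 ·c+ 37) ∷ (⟨ 0 , 0 , 9 ⟩ , 0 ·c+ 36) ∷
      (⟨ 0 , 0 , 10 ⟩ , 0 ·c+ 36) ∷ (⟨ 0 , 0 , 11 ⟩ , 0 ·c+ 36) ∷ (⟨ 0 , 0 , 12 ⟩ , 0 ·c+ 36) ∷
      (⟨ 0 , 0 , 13 ⟩ , 0 ·c+ 36) ∷ (⟨ 0 , 0 , 14 ⟩ , 0 ·c+ 36) ∷ (⟨ 0 , 0 , 15 ⟩ , 0 ·c+ 37) ∷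
      (⟨ 0 , 0 , 16 ⟩ , 0 ·c+ 36) ∷ (⟨ 0 , 0 , 17 ⟩ , 0 ·c+ 36) ∷ (⟨ 0 , 0 , 18 ⟩ , 0 ·c+ 36) ∷
      (⟨ 0 , 0 , 19 ⟩ , 0 ·c+ 36) ∷ (⟨ 0 , 0 , 20 ⟩ , 0 ·c+ 36) ∷ (⟨ 0 , 0 , 21 ⟩ , 0 ·c+ 36) ∷
      (⟨ 0 , 0 , 22 ⟩ , 0 ·c+ 38) ∷
      []
  ; repeat-table   =
      (⟨ 0 , 0 , 1 ⟩ , 0 ·c+ 0) ∷ (⟨ 0 , 0 , 2 ⟩ , 0 ·c+ 0) ∷ (⟨ 0 , 0 , 3 ⟩ , 0 ·c+ 0) ∷
      (⟨ 0 , 0 , 4 ⟩ , 0 ·c+ 0) ∷ (⟨ 0 , 0 , 6 ⟩ , 0 ·c+ 4) ∷ (⟨ 0 , 0 , 7 ⟩ , 0 ·c+ 3) ∷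
      (⟨ 0 , 0 , 8 ⟩ , 0 ·c+ 2) ∷ (⟨ 0 , 0 , 9 ⟩ , 0 ·c+ 1) ∷ (⟨ 0 , 0 , 10 ⟩ , 0 ·c+ 0) ∷
      (⟨ 0 , 0 , 11 ⟩ , 0 ·c+ 0) ∷ (⟨ 0 , 0 , 13 ⟩ , 0 ·c+ 4) ∷ (⟨ 0 , 0 , 14 ⟩ , 0 ·c+ 3) ∷
      (⟨ 0 , 0 , 15 ⟩ , 0 ·c+ 2) ∷ (⟨ 0 , 0 , 16 ⟩ , 0 ·c+ 1) ∷ (⟨ 0 , 0 , 17 ⟩ , 0 ·c+ 0) ∷
      (⟨ 0 , 0 , 20 ⟩ , 0 ·c+ 4) ∷ (⟨ 0 , 0 , 21 ⟩ , 0 ·c+ 3) ∷ (⟨ 0 , 0 , 22 ⟩ , 0 ·c+ 2) ∷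
      []
  ; shifted-table  =
      (⟨ 0 , 0 , 0 ⟩ , 0 ·c+ 1) ∷ (⟨ 0 , 0 , 1 ⟩ , 0 ·c+ 0) ∷ (⟨ 0 , 0 , 2 ⟩ , 0 ·c+ 0) ∷
      (⟨ 0 , 0 , 3 ⟩ , 0 ·c+ 0) ∷ (⟨ 0 , 0 , 4 ⟩ , 0 ·c+ 0) ∷ (⟨ 0 , 0 , 5 ⟩ , 0 ·c+ 23) ∷
      (⟨ 0 , 0 , 6 ⟩ , 0 ·c+ 4) ∷ (⟨ 0 , 0 , 7 ⟩ , 0 ·c+ 3) ∷ (⟨ 0 , 0 , 8 ⟩ , 0 ·c+ 2) ∷
      (⟨ 0 , 0 , 9 ⟩ , 0 ·c+ 1) ∷ (⟨ 0 , 0 , 10 ⟩ , 0 ·c+ 0) ∷ (⟨ 0 , 0 , 11 ⟩ , 0 ·c+ 0) ∷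
      (⟨ 0 , 0 , 12 ⟩ , 0 ·c+ 23) ∷ (⟨ 0 , 0 , 13 ⟩ , 0 ·c+ 4) ∷ (⟨ 0 , 0 , 14 ⟩ , 0 ·c+ 3) ∷
      (⟨ 0 , 0 , 15 ⟩ , 0 ·c+ 2) ∷ (⟨ 0 , 0 , 16 ⟩ , 0 ·c+ 1) ∷ (⟨ 0 , 0 , 17 ⟩ , 0 ·c+ 0) ∷
      (⟨ 0 , 0 , 18 ⟩ , 0 ·c+ 0) ∷ (⟨ 0 , 0 , 20 ⟩ , 0 ·c+ 4) ∷ (⟨ 0 , 0 , 21 ⟩ , 0 ·c+ 3) ∷
      (⟨ 0 , 0 , 22 ⟩ , 0 ·c+ 2) ∷
      []
  ; shifted-table₂ =
      (⟨ 0 , 0 , 0 ⟩ , 0 ·c+ 1) ∷ (⟨ 0 , 0 , 1 ⟩ , 0 ·c+ 0) ∷ (⟨ 0 , 0 , 2 ⟩ , 0 ·c+ 0) ∷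
      (⟨ 0 , 0 , 3 ⟩ , 0 ·c+ 0) ∷ (⟨ 0 , 0 , 4 ⟩ , 0 ·c+ 0) ∷ (⟨ 0 , 0 , 5 ⟩ , 0 ·c+ 23) ∷
      (⟨ 0 , 0 , 6 ⟩ , 0 ·c+ 4) ∷ (⟨ 0 , 0 , 7 ⟩ , 0 ·c+ 3) ∷ (⟨ 0 , 0 , 8 ⟩ , 0 ·c+ 2) ∷
      (⟨ 0 , 0 , 9 ⟩ , 0 ·c+ 1) ∷ (⟨ 0 , 0 , 10 ⟩ , 0 ·c+ 0) ∷ (⟨ 0 , 0 , 11 ⟩ , 0 ·c+ 0) ∷
      (⟨ 0 , 0 , 12 ⟩ , 0 ·c+ 23) ∷ (⟨ 0 , 0 , 13 ⟩ , 0 ·c+ 4) ∷ (⟨ 0 , 0 , 14 ⟩ , 0 ·c+ 3) ∷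
      (⟨ 0 , 0 , 15 ⟩ , 0 ·c+ 2) ∷ (⟨ 0 , 0 , 16 ⟩ , 0 ·c+ 1) ∷ (⟨ 0 , 0 , 17 ⟩ , 0 ·c+ 0) ∷
      (⟨ 0 , 0 , 18 ⟩ , 0 ·c+ 0) ∷ (⟨ 0 , 0 , 20 ⟩ , 0 ·c+ 4) ∷ (⟨ 0 , 0 , 21 ⟩ , 0 ·c+ 3) ∷
      (⟨ 0 , 0 , 22 ⟩ , 0 ·c+ 2) ∷
      []
  }

profile₅ : PeriodicProfile (grundy (Sub 5)) 23 (nimSeq 5) (_∈ Sub 5) (Seed 5)
profile₅ = Certified.profile certificate₅ 5 (n≤1+n 4) describes _
  where
  open Symbolic 0
  describes : Certified.Describes certificate₅ 5
  describes = record
    { moves≡ = refl ; prefix≡ = refl ; block≡ = refl ; window≡ = refl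
    ; seeds≐ = single-seed 0 5 (0 ·c+ 19) ≤-refl refl }

-- The certificate for the games a = 6 + c, uniformly in c: runs of length c + k stretch with a.
certificate₆₊ : Certificate
certificate₆₊ = record
  { moves          = 1 ·c+ 6 ∷ 2 ·c+ 14 ∷ 3 ·c+ 21 ∷ []
  ; seeds          = 3 ·c+ 22 ∷ []
  ; prefix         =
      run 0 1 6 ∷ run 1 1 6 ∷ run 0 0 2 ∷ run 2 1 4 ∷ run 1 0 2 ∷
      run 0 0 1 ∷ run 3 1 3 ∷ run 2 0 2 ∷ run 1 0 1 ∷ run 2 0 1 ∷
      run 0 1 5 ∷ run 3 0 1 ∷ run 1 1 5 ∷ run 0 0 2 ∷ run 3 0 1 ∷
      []
  ; block₁         =
      run 2 1 3 ∷ run 1 0 2 ∷ run 0 0 2 ∷ run 3 1 2 ∷ run 2 0 2 ∷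
      run 1 0 2 ∷ run 0 1 5 ∷ run 2 0 1 ∷ run 1 1 5 ∷ run 0 0 2 ∷
      []
  ; block₂         = run 2 0 1 ∷ []
  ; shorter-table  =
      (⟨ 0 , 1 , 1 ⟩ , 7 ·c+ 48) ∷ (⟨ 1 , 0 , 3 ⟩ , 6 ·c+ 42) ∷ (⟨ 1 , 0 , 4 ⟩ , 6 ·c+ 42) ∷
      (⟨ 1 , 0 , 5 ⟩ , 6 ·c+ 42) ∷ (⟨ 1 , 0 , 6 ⟩ , 6 ·c+ 42) ∷ (⟨ 1 , 1 , 7 ⟩ , 6 ·c+ 42) ∷
      (⟨ 2 , 0 , 9 ⟩ , 6 ·c+ 44) ∷ (⟨ 2 , 0 , 10 ⟩ , 6 ·c+ 43) ∷ (⟨ 2 , 0 , 11 ⟩ , 6 ·c+ 42) ∷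
      (⟨ 2 , 0 , 12 ⟩ , 6 ·c+ 42) ∷ (⟨ 2 , 1 , 13 ⟩ , 6 ·c+ 42) ∷ (⟨ 3 , 0 , 18 ⟩ , 6 ·c+ 43) ∷
      (⟨ 3 , 1 , 19 ⟩ , 6 ·c+ 42) ∷ (⟨ 4 , 0 , 24 ⟩ , 6 ·c+ 42) ∷ (⟨ 4 , 0 , 25 ⟩ , 6 ·c+ 42) ∷
      (⟨ 4 , 0 , 26 ⟩ , 7 ·c+ 45) ∷
      []
  ; repeat-table   =
      (⟨ 0 , 1 , 0 ⟩ , 0 ·c+ 0) ∷ (⟨ 1 , 0 , 3 ⟩ , 0 ·c+ 0) ∷ (⟨ 1 , 0 , 4 ⟩ , 0 ·c+ 0) ∷
      (⟨ 1 , 0 , 5 ⟩ , 0 ·c+ 0) ∷ (⟨ 1 , 1 , 7 ⟩ , 7 ·c+ 48) ∷ (⟨ 2 , 0 , 9 ⟩ , 0 ·c+ 3) ∷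
      (⟨ 2 , 0 , 10 ⟩ , 0 ·c+ 2) ∷ (⟨ 2 , 0 , 11 ⟩ , 0 ·c+ 1) ∷ (⟨ 2 , 0 , 12 ⟩ , 0 ·c+ 0) ∷
      (⟨ 2 , 0 , 13 ⟩ , 0 ·c+ 0) ∷ (⟨ 2 , 1 , 15 ⟩ , 2 ·c+ 13) ∷ (⟨ 3 , 0 , 18 ⟩ , 0 ·c+ 2) ∷
      (⟨ 3 , 0 , 19 ⟩ , 0 ·c+ 1) ∷ (⟨ 3 , 0 , 20 ⟩ , 0 ·c+ 0) ∷ (⟨ 3 , 1 , 23 ⟩ , 1 ·c+ 5) ∷
      (⟨ 4 , 0 , 24 ⟩ , 0 ·c+ 4) ∷ (⟨ 4 , 0 , 25 ⟩ , 0 ·c+ 3) ∷ (⟨ 4 , 0 , 26 ⟩ , 0 ·c+ 2) ∷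
      []
  ; shifted-table  =
      (⟨ 0 , 1 , 0 ⟩ , 0 ·c+ 1) ∷ (⟨ 1 , 0 , 3 ⟩ , 0 ·c+ 0) ∷ (⟨ 1 , 0 , 4 ⟩ , 0 ·c+ 0) ∷
      (⟨ 1 , 0 , 5 ⟩ , 0 ·c+ 0) ∷ (⟨ 1 , 0 , 6 ⟩ , 4 ·c+ 27) ∷ (⟨ 1 , 1 , 7 ⟩ , 7 ·c+ 48) ∷
      (⟨ 2 , 0 , 9 ⟩ , 0 ·c+ 3) ∷ (⟨ 2 , 0 , 10 ⟩ , 0 ·c+ 2) ∷ (⟨ 2 , 0 , 11 ⟩ , 0 ·c+ 1) ∷
      (⟨ 2 , 0 , 12 ⟩ , 0 ·c+ 0) ∷ (⟨ 2 , 0 , 13 ⟩ , 0 ·c+ 0) ∷ (⟨ 2 , 0 , 14 ⟩ , 4 ·c+ 27) ∷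
      (⟨ 2 , 1 , 15 ⟩ , 2 ·c+ 13) ∷ (⟨ 3 , 0 , 18 ⟩ , 0 ·c+ 2) ∷ (⟨ 3 , 0 , 19 ⟩ , 0 ·c+ 1) ∷
      (⟨ 3 , 0 , 20 ⟩ , 0 ·c+ 0) ∷ (⟨ 3 , 0 , 21 ⟩ , 0 ·c+ 0) ∷ (⟨ 3 , 1 , 23 ⟩ , 1 ·c+ 5) ∷
      (⟨ 4 , 0 , 24 ⟩ , 0 ·c+ 4) ∷ (⟨ 4 , 0 , 25 ⟩ , 0 ·c+ 3) ∷ (⟨ 4 , 0 , 26 ⟩ , 0 ·c+ 2) ∷
      []
  ; shifted-table₂ =
      (⟨ 0 , 1 , 0 ⟩ , 0 ·c+ 1) ∷ (⟨ 1 , 0 , 3 ⟩ , 0 ·c+ 0) ∷ (⟨ 1 , 0 , 4 ⟩ , 0 ·c+ 0) ∷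
      (⟨ 1 , 0 , 5 ⟩ , 0 ·c+ 0) ∷ (⟨ 1 , 0 , 6 ⟩ , 4 ·c+ 27) ∷ (⟨ 1 , 1 , 7 ⟩ , 7 ·c+ 48) ∷
      (⟨ 2 , 0 , 9 ⟩ , 0 ·c+ 3) ∷ (⟨ 2 , 0 , 10 ⟩ , 0 ·c+ 2) ∷ (⟨ 2 , 0 , 11 ⟩ , 0 ·c+ 1) ∷
      (⟨ 2 , 0 , 12 ⟩ , 0 ·c+ 0) ∷ (⟨ 2 , 0 , 13 ⟩ , 0 ·c+ 0) ∷ (⟨ 2 , 0 , 14 ⟩ , 4 ·c+ 27) ∷
      (⟨ 2 , 1 , 15 ⟩ , 2 ·c+ 13) ∷ (⟨ 3 , 0 , 18 ⟩ , 0 ·c+ 2) ∷ (⟨ 3 , 0 , 19 ⟩ , 0 ·c+ 1) ∷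
      (⟨ 3 , 0 , 20 ⟩ , 0 ·c+ 0) ∷ (⟨ 3 , 0 , 21 ⟩ , 0 ·c+ 0) ∷ (⟨ 3 , 1 , 23 ⟩ , 1 ·c+ 5) ∷
      (⟨ 4 , 0 , 24 ⟩ , 0 ·c+ 4) ∷ (⟨ 4 , 0 , 25 ⟩ , 0 ·c+ 3) ∷ (⟨ 4 , 0 , 26 ⟩ , 0 ·c+ 2) ∷
      []
  }

profile₆₊ : ∀ c → PeriodicProfile (grundy (Sub (6 + c))) (3 + 4 * (6 + c)) (nimSeq (6 + c))
                                  (_∈ Sub (6 + c)) (Seed (6 + c))
profile₆₊ c = Certified.profile certificate₆₊ (6 + c) (m≤m+n 4 (2 + c)) describes _
  where
  open Symbolic c
  describes : Certified.Describes certificate₆₊ (6 + c)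
  describes = record
    { moves≡  = cong₂ _∷_ (solve 1 (λ c → con 1 :* c :+ con 6 := con 6 :+ c) refl c)
               (cong₂ _∷_ (solve 1 (λ c → con 2 :* c :+ con 14 := con 2 :* (con 6 :+ c) :+ con 2) refl c)
               (cong₂ _∷_ (solve 1 (λ c → con 3 :* c :+ con 21 := con 3 :* (con 6 :+ c) :+ con 3) refl c) refl))
    ; prefix≡ = solve 1 (λ c → con 6 :* c :+ con 42 := con 6 :* (con 6 :+ c) :+ con 6) refl c
    ; block≡  = solve 1 (λ c → con 4 :* c :+ con 27 := con 3 :+ con 4 :* (con 6 :+ c)) refl c
    ; window≡ = window
    ; seeds≐  = single-seed c (6 + c) (3 ·c+ 22) (m≤m+n 5 (1 + c))
                  (solve 1 (λ c → con 3 :* c :+ con 22 := con 3 :* (con 6 :+ c) :+ con 4) refl c)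
    }
    where
    window : expand (Certificate.block₂ certificate₆₊ ++ Certificate.block₁ certificate₆₊) ≡ nimSeq (6 + c)
    window rewrite +-identityʳ c | +-comm c 3 | +-comm c 2 | +-comm c 5 = refl

profile : ∀ a → 4 ≤ a → PeriodicProfile (grundy (Sub a)) (3 + 4 * a) (nimSeq a) (_∈ Sub a) (Seed a)
profile .(4 + b) (s≤s (s≤s (s≤s (s≤s {n = b} z≤n)))) with b
... | zero          = profile₄
... | suc zero      = profile₅
... | suc (suc c)   = profile₆₊ c

expansion-of : ∀ a → 4 ≤ a → (E : ℕ → Set) →
  (∀ s → s ∈ Sub a ⊎ Star (Seed a) (3 + 4 * a) s → E s) →
  (∀ s → E s → s ∈ Sub a ⊎ Star (Seed a) (3 + 4 * a) s) → HasExpansion (Sub a) E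
expansion-of a 4≤a E to from s with profile-expansion (profile a 4≤a) (_∈? Sub a) (Seed? a) s
... | separating⇒ , ⇒separating = to s ∘ separating⇒ , ⇒separating ∘ from s

∈Sub→cases : ∀ {a s} → s ∈ Sub a → s ≡ a ⊎ s ≡ 2 * a + 2 ⊎ s ≡ 3 * a + 3
∈Sub→cases (here s≡)                 = inj₁ s≡
∈Sub→cases (there (here s≡))         = inj₂ (inj₁ s≡)
∈Sub→cases (there (there (here s≡))) = inj₂ (inj₂ s≡)

cases→∈Sub : ∀ {a s} → s ≡ a ⊎ s ≡ 2 * a + 2 ⊎ s ≡ 3 * a + 3 → s ∈ Sub a
cases→∈Sub (inj₁ s≡)        = here s≡
cases→∈Sub (inj₂ (inj₁ s≡)) = there (here s≡)
cases→∈Sub (inj₂ (inj₂ s≡)) = there (there (here s≡))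

theorem6p3 : (a : ℕ) → 4 ≤ a →
    UltPeriodic (grundy (a ∷ (2 * a + 2) ∷ (3 * a + 3) ∷ [])) (3 + 4 * a)
      (replicate (a ∸ 2) 2 ++ (1 ∷ 1 ∷ 0 ∷ 0 ∷ []) ++ replicate (a ∸ 4) 3 ++ (2 ∷ 2 ∷ 1 ∷ 1 ∷ [])
        ++ replicate (a ∸ 1) 0 ++ (2 ∷ []) ++ replicate (a ∸ 1) 1 ++ (0 ∷ 0 ∷ []))
    × (a ≡ 4 → NonExpandable (a ∷ (2 * a + 2) ∷ (3 * a + 3) ∷ []) (3 + 4 * a))
    × (a ≢ 4 → HasExpansion (a ∷ (2 * a + 2) ∷ (3 * a + 3) ∷ [])
         (λ s → (s ≡ a ⊎ s ≡ 2 * a + 2 ⊎ s ≡ 3 * a + 3)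
                ⊎ Star (λ x → x ≡ 3 * a + 4) (3 + 4 * a) s))
theorem6p3 a 4≤a = profile-periodic (profile a 4≤a) , non-expandable , expansion
  where
  non-expandable : a ≡ 4 → NonExpandable (Sub a) (3 + 4 * a)
  non-expandable refl = inj₁ (expansion-of 4 4≤a (_∈ Sub 4) without-seed (λ _ → inj₁))
    where
    without-seed : ∀ s → s ∈ Sub 4 ⊎ Star (Seed 4) 19 s → s ∈ Sub 4
    without-seed s (inj₁ s∈) = s∈
    without-seed s (inj₂ (_ , _ , (s≤s (s≤s (s≤s (s≤s ()))) , _) , _))
  expansion : a ≢ 4 → HasExpansion (Sub a)
    (λ s → (s ≡ a ⊎ s ≡ 2 * a + 2 ⊎ s ≡ 3 * a + 3) ⊎ Star (λ x → x ≡ 3 * a + 4) (3 + 4 * a) s)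
  expansion a≢4 = expansion-of a 4≤a _
    (λ { s (inj₁ s∈) → inj₁ (∈Sub→cases s∈) ; s (inj₂ (x , m , (_ , x≡) , s≡)) → inj₂ (x , m , x≡ , s≡) })
    (λ { s (inj₁ s≡) → inj₁ (cases→∈Sub s≡) ; s (inj₂ (x , m , x≡ , s≡)) → inj₂ (x , m , (5≤a , x≡) , s≡) })
    where
    5≤a : 5 ≤ a
    5≤a = ≤∧≢⇒< 4≤a (a≢4 ∘ sym)
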